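{- For every $A = \begin{pmatrix} a & b \\ c & d\end{pmatrix} \in \Gamma_\theta$ with $c \neq 0$, we have $\mathfrak{S}(A) = I_\theta(a/c)$, i.e. $\mathfrak{S}(A) = I_\theta(A.i\infty)$.
   Context: $\Gamma_\theta = \{\begin{pmatrix} a&b\\c&d\end{pmatrix}\in \mathrm{SL}_2(\mathbf{Z}) : a\equiv d,\ b\equiv c \pmod 2\}$, acting on $\mathbf{H}\cup\mathbf{Q}\cup\{i\infty\}$ by Möbius transformations. For $A=\begin{pmatrix} a&b\\c&d\end{pmatrix}\in\Gamma_\theta$ with $c\ne0$ (then $a+c$ is odd), $\mathfrak{S}(A)=\sum_{k=1}^{|c|-1}(-1)^{\lfloor ka/c\rfloor+k+1}$. $\mathbf{Q}_\theta$ is the set of rationals $a/c$ with $\gcd(a,c)=1$, $c\ge1$, $a+c$ odd. The net $\mathcal{N}_\theta$: for each pair of rationals $a/c,b/d$ in lowest terms with $c,d\ge1$, $a,b,c,d$ odd and $ad-bc=\pm2$, take the geodesic joining them, oriented from $a/c$ to $b/d$ if $c<d$, from $b/d$ to $a/c$ if $d<c$, and doubly oriented if $c=d$. For oriented geodesics $g,h$, $\varphi_g(h)=0$ if $g\cap h=\emptyset$ or $g$ is doubly oriented; otherwise, with $v$, $w$ the tangent directions of $h$, $g$ at the intersection point, $\varphi_g(h)=+1$ if $\det(v,w)<0$ ($g$ points to the right of $h$) and $-1$ if $\det(v,w)>0$. For $x\in\mathbf{Q}_\theta$, $h_x$ is the oriented geodesic from $i\infty$ to $x$ and $I_\theta(x)=\sum_{g\in\mathcal{N}_\theta}\varphi_g(h_x)$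 (a finite sum). -}

module Defs where

open import Data.Nat as ℕ using (ℕ; zero; suc; _∸_)
open import Data.Integer as ℤ using (ℤ; +_; -[1+_]; _+_; _*_; -_; _-_; 0ℤ; 1ℤ; -1ℤ; ∣_∣; _<_; _/ℕ_; _%ℕ_)
open import Data.Integer.Divisibility using (_∣_)
open import Data.Integer.GCD using (gcd)
open import Data.Bool using (Bool; true; false; if_then_else_; _∧_)
open import Data.List using (List; []; _∷_; map; foldr; upTo)
open import Data.List.Relation.Unary.All using (All)
open import Data.List.Relation.Unary.Unique.Propositional using (Unique)
open import Data.List.Membership.Propositional using (_∈_)
open import Data.Product using (Σ; _×_; _,_)
open import Data.Sum using (_⊎_)
open import Relation.Nullary.Decidable using (⌊_⌋)
open import Relation.Binary.PropositionalEquality using (_≡_; _≢_)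

InΓθ : ℤ → ℤ → ℤ → ℤ → Set
InΓθ a b c d = (a * d - b * c ≡ 1ℤ) × ((+ 2) ∣ (a - d)) × ((+ 2) ∣ (b - c))

-- ⌊ n / m ⌋ for m ≠ 0 (value at m = 0 is irrelevant)
floorDiv : ℤ → ℤ → ℤ
floorDiv n (+ zero)    = 0ℤ
floorDiv n (+ (suc m)) = n /ℕ suc m
floorDiv n -[1+ m ]    = (- n) /ℕ suc m

negOnePow : ℤ → ℤ
negOnePow n with n %ℕ 2
... | zero  = 1ℤ
... | suc _ = -1ℤ

sumℤ : List ℤ → ℤ
sumℤ = foldr _+_ 0ℤ

-- k ranges over 1, …, |c| - 1
frakS : ℤ → ℤ → ℤ
frakS a c = sumℤ (map (λ k → negOnePow (floorDiv (+ k * a) c + + k + 1ℤ))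
                      (map suc (upTo (∣ c ∣ ∸ 1))))

-- A.i∞ = a/c, written with positive denominator: numerator and denominator

infNum : ℤ → ℤ → ℤ
infNum a (+ n)     = a
infNum a -[1+ m ]  = - a

infDen : ℤ → ℕ
infDen c = ∣ c ∣

-- A geodesic of the net is stored as (a , c , b , d) meaning the geodesic
-- with endpoints a/c and b/d, canonically ordered so that a/c < b/d
-- (i.e. a*d < b*c as c, d ≥ 1); each net geodesic has exactly one such
-- representation.

Geod : Set
Geod = ℤ × ℤ × ℤ × ℤ

Odd : ℤ → Set
Odd n = (+ 2) ∣ (n - 1ℤ)

IsNet : Geod → Set
IsNet (a , c , b , d) =
  (0ℤ < c) × (0ℤ < d) × (gcd a c ≡ 1ℤ) × (gcd b d ≡ 1ℤ) ×
  Odd a × Odd b × Odd c × Odd d ×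
  ((a * d - b * c ≡ + 2) ⊎ (a * d - b * c ≡ - + 2)) ×
  (a * d < b * c)

-- φ_g(h_x) for x = p/q (q ≥ 1), h_x the downward vertical geodesic from i∞
-- to x and g the geodesic stored as (a , c , b , d) with a/c < b/d.
-- g meets h_x iff a/c < x < b/d.  If c < d, g runs from a/c (left) to b/d
-- (right): it points to the left of h_x, φ = -1.  If d < c it runs right
-- to left, φ = +1.  If c = d it is doubly oriented, φ = 0.
orientSign : ℤ → ℤ → ℤ
orientSign c d =
  if ⌊ c ℤ.<? d ⌋ then -1ℤ else (if ⌊ d ℤ.<? c ⌋ then 1ℤ else 0ℤ)

φ : ℤ → ℕ → Geod → ℤ
φ p q (a , c , b , d) =
  if ⌊ a * + q ℤ.<? p * c ⌋ ∧ ⌊ p * d ℤ.<? b * + q ⌋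
  then orientSign c d else 0ℤ

-- I_θ(p/q) = n : the (finitely supported) sum Σ_{g ∈ 𝒩_θ} φ_g(h_{p/q})
-- equals n, witnessed by a duplicate-free list of net geodesics containing
-- every net geodesic with nonzero contribution.
IθIs : ℤ → ℕ → ℤ → Set
IθIs p q n =
  Σ (List Geod) λ L →
    Unique L × All IsNet L ×
    (∀ g → IsNet g → φ p q g ≢ 0ℤ → g ∈ L) ×
    (sumℤ (map (φ p q) L) ≡ n)

-- Both sides are followed along the descent by which Γ_θ is generated: x ↦ x + 2, x ↦ -x and, for
-- 0 < x < 1, x ↦ 1/x, down to denominator 1 where both vanish. 𝔖 is unchanged by p ↦ p + 2q, changes
-- sign under p ↦ -p, and satisfies the reciprocity law 𝔖(p/q) + 𝔖(q/p) = 1 for coprime p, q with p + q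
-- odd, proved by counting lattice points on either side of the line of slope p/q as for Dedekind sums.
-- On the net, translation and reflection are symmetries preserving, resp. reversing, all orientations.
-- Inversion maps the geodesics crossing h_{q/p} onto those crossing h_{p/q} except the one joining -1
-- and 1, and it reverses every orientation, except that on the geodesic joining the two odd integers
-- around q/p the orientations before and after add up to 1; hence I_θ(p/q) = 1 - I_θ(q/p).

module Submission where

open import Defs
open import Data.Integer using (ℤ; 0ℤ)
open import Relation.Binary.PropositionalEquality using (_≢_)
open import Data.Nat as ℕ using (ℕ; zero; suc)
import Data.Nat.Properties as ℕP
import Data.Nat.DivMod as ℕD
import Data.Nat.Divisibility as ℕDiv
import Data.Nat.GCD as ℕGCD
open import Data.Nat.Induction using (<-rec)
open import Data.Integer
  using (+_; -[1+_]; +[1+_]; +<+; +≤+; -<+; -_; 1ℤ; -1ℤ; _+_; _*_; _-_; _<_; _≤_; _%ℕ_; _/ℕ_; ∣_∣; nonNegative; positive)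
open import Data.Integer.Properties
import Data.Integer as ℤ
open import Data.Integer.DivMod using (a≡a%ℕn+[a/ℕn]*n; n%ℕd<d; [n/ℕd]*d≤n; n<s[n/ℕd]*d)
import Data.Integer.Divisibility as ℤDiv
import Data.Integer.Divisibility.Signed as Signed
open import Data.Integer.GCD using (gcd; gcd[i,j]∣i; gcd[i,j]∣j)
open import Data.Integer.Tactic.RingSolver using (solve-∀; solve)
open import Data.Product using (∃-syntax; _×_; _,_; proj₁; proj₂)
open import Data.Sum using (_⊎_; inj₁; inj₂)
open import Data.Empty using (⊥; ⊥-elim)
open import Data.Bool using (_∧_; if_then_else_)
open import Data.List using (List; []; _∷_; _∷ʳ_; map; upTo)
import Data.List.Properties as List
open import Data.List.Relation.Unary.All as All using (All)
import Data.List.Relation.Unary.All.Properties as All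
open import Data.List.Relation.Unary.Any using (here; there)
import Data.List.Relation.Unary.AllPairs as AllPairs
open import Data.List.Relation.Unary.Unique.Propositional using (Unique)
import Data.List.Relation.Unary.Unique.Propositional.Properties as Unique
open import Data.List.Membership.Propositional using (_∈_)
open import Data.List.Membership.Propositional.Properties using (∈-map⁺)
open import Relation.Binary.Definitions using (tri<; tri≈; tri>)
open import Relation.Binary.PropositionalEquality
open import Relation.Nullary using (¬_; Dec; yes; no; _×-dec_)
open import Relation.Nullary.Decidable using (⌊_⌋)
open import Function using (_∋_; _∘_; id)

Even : ℤ → Set
Even n = ∃[ t ] n ≡ + 2 * t

Odd′ : ℤ → Set
Odd′ n = ∃[ t ] n ≡ + 2 * t + 1ℤ

2*i≢1 : ∀ i → + 2 * i ≢ 1ℤ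
2*i≢1 i eq with ℕP.m*n≡1⇒m≡1 2 ∣ i ∣ (trans (sym (abs-* (+ 2) i)) (cong ∣_∣ eq))
... | ()

¬Even∧Odd′ : ∀ {n} → Even n → Odd′ n → ⊥
¬Even∧Odd′ {n} (t , n≡2t) (s , n≡2s+1) = 2*i≢1 (t - s) (begin
    + 2 * (t - s)          ≡⟨ solve (t ∷ s ∷ []) ⟩
    + 2 * t - + 2 * s      ≡⟨ cong (_- + 2 * s) (trans (sym n≡2t) n≡2s+1) ⟩
    + 2 * s + 1ℤ - + 2 * s ≡⟨ solve (s ∷ []) ⟩
    1ℤ                     ∎)
  where open ≡-Reasoning

negOnePow-parity : ∀ n → (Even n × negOnePow n ≡ 1ℤ) ⊎ (Odd′ n × negOnePow n ≡ -1ℤ)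
negOnePow-parity n with n %ℕ 2 | n%ℕd<d n 2 | a≡a%ℕn+[a/ℕn]*n n 2
... | zero        | _                | n≡ = inj₁ ((n /ℕ 2 , trans n≡ (even-form (n /ℕ 2))) , refl)
  where
  even-form : ∀ q → + 0 + q * + 2 ≡ + 2 * q
  even-form q = solve (q ∷ [])
... | suc zero    | _                | n≡ = inj₂ ((n /ℕ 2 , trans n≡ (odd-form (n /ℕ 2))) , refl)
  where
  odd-form : ∀ q → + 1 + q * + 2 ≡ + 2 * q + 1ℤ
  odd-form q = solve (q ∷ [])
... | suc (suc _) | ℕ.s≤s (ℕ.s≤s ()) | _

parity : ∀ n → Even n ⊎ Odd′ n
parity n with negOnePow-parity n
... | inj₁ (even , _) = inj₁ even
... | inj₂ (odd , _)  = inj₂ odd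

negOnePow-even : ∀ {n} → Even n → negOnePow n ≡ 1ℤ
negOnePow-even {n} even with negOnePow-parity n
... | inj₁ (_ , eq)  = eq
... | inj₂ (odd , _) = ⊥-elim (¬Even∧Odd′ even odd)

negOnePow-odd : ∀ {n} → Odd′ n → negOnePow n ≡ -1ℤ
negOnePow-odd {n} odd with negOnePow-parity n
... | inj₁ (even , _) = ⊥-elim (¬Even∧Odd′ even odd)
... | inj₂ (_ , eq)   = eq

Even-+ : ∀ {m n} → Even m → Even n → Even (m + n)
Even-+ (s , refl) (t , refl) = s + t , solve (s ∷ t ∷ [])

Odd′-+-Even : ∀ {m n} → Odd′ m → Even n → Odd′ (m + n)
Odd′-+-Even (s , refl) (t , refl) = s + t , solve (s ∷ t ∷ [])

Odd′-+-Odd′ : ∀ {m n} → Odd′ m → Odd′ n → Even (m + n)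
Odd′-+-Odd′ (s , refl) (t , refl) = s + t + 1ℤ , solve (s ∷ t ∷ [])

Even-neg : ∀ {n} → Even n → Even (- n)
Even-neg (t , refl) = - t , solve (t ∷ [])

Odd′-neg : ∀ {n} → Odd′ n → Odd′ (- n)
Odd′-neg (t , refl) = - t - 1ℤ , solve (t ∷ [])

Even-2* : ∀ t → Even (+ 2 * t)
Even-2* t = t , refl

Odd′-1 : Odd′ 1ℤ
Odd′-1 = 0ℤ , refl

negOnePow-+-even : ∀ n {e} → Even e → negOnePow (n + e) ≡ negOnePow n
negOnePow-+-even n even-e with parity n
... | inj₁ even = trans (negOnePow-even (Even-+ even even-e)) (sym (negOnePow-even even))
... | inj₂ odd  = trans (negOnePow-odd (Odd′-+-Even odd even-e)) (sym (negOnePow-odd odd))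

negOnePow-suc : ∀ n → negOnePow (n + 1ℤ) ≡ - negOnePow n
negOnePow-suc n with parity n
... | inj₁ even = trans (negOnePow-odd (subst Odd′ (+-comm 1ℤ n) (Odd′-+-Even Odd′-1 even)))
                        (cong -_ (sym (negOnePow-even even)))
... | inj₂ odd  = trans (negOnePow-even (Odd′-+-Odd′ odd Odd′-1)) (cong -_ (sym (negOnePow-odd odd)))

negOnePow-neg : ∀ n → negOnePow (- n) ≡ negOnePow n
negOnePow-neg n with parity n
... | inj₁ even = trans (negOnePow-even (Even-neg even)) (sym (negOnePow-even even))
... | inj₂ odd  = trans (negOnePow-odd (Odd′-neg odd)) (sym (negOnePow-odd odd))

Odd′⇒Odd : ∀ {n} → Odd′ n → Odd n
Odd′⇒Odd (t , refl) = Signed.∣⇒∣ᵤ {+ 2} {+ 2 * t + 1ℤ - 1ℤ} (Signed.divides t (solve (t ∷ [])))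

Odd⇒Odd′ : ∀ {n} → Odd n → Odd′ n
Odd⇒Odd′ {n} 2∣n-1 with Signed.∣ᵤ⇒∣ {+ 2} {n - 1ℤ} 2∣n-1
... | Signed.divides t eq = t , (begin
    n              ≡⟨ solve (n ∷ []) ⟩
    n - 1ℤ + 1ℤ    ≡⟨ cong (_+ 1ℤ) eq ⟩
    t * + 2 + 1ℤ   ≡⟨ solve (t ∷ []) ⟩
    + 2 * t + 1ℤ   ∎)
  where open ≡-Reasoning

2∣⇒Even : ∀ {n} → + 2 ℤDiv.∣ n → Even n
2∣⇒Even {n} 2∣n with Signed.∣ᵤ⇒∣ {+ 2} {n} 2∣n
... | Signed.divides t eq = t , trans eq (*-comm t (+ 2))

Odd′⇒≢0 : ∀ {n} → Odd′ n → n ≢ 0ℤ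
Odd′⇒≢0 odd refl = ¬Even∧Odd′ (0ℤ , refl) odd

0<1+n : ∀ n → 0ℤ < + suc n
0<1+n n = +<+ ℕ.z<s

0≤-* : ∀ {x y} → 0ℤ ≤ x → 0ℤ ≤ y → 0ℤ ≤ x * y
0≤-* {+ m} {+ n} _ _ = subst (0ℤ ≤_) (pos-* m n) (+≤+ ℕ.z≤n)

0<-* : ∀ {x y} → 0ℤ < x → 0ℤ < y → 0ℤ < x * y
0<-* {+[1+ m ]} {+[1+ n ]} (+<+ _) (+<+ _) = +<+ ℕ.z<s

0<⇒0≤-1 : ∀ {x} → 0ℤ < x → 0ℤ ≤ x - 1ℤ
0<⇒0≤-1 {+[1+ n ]} (+<+ _) = +≤+ ℕ.z≤n

0<*⇒0< : ∀ {x y} → 0ℤ < y → 0ℤ < x * y → 0ℤ < x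
0<*⇒0< {x} {y} 0<y = *-cancelʳ-<-nonNeg y ⦃ nonNegative (<⇒≤ 0<y) ⦄

i<j⇒0<j-i : ∀ {i j} → i < j → 0ℤ < j - i
i<j⇒0<j-i {i} {j} i<j = subst (_< j - i) (+-inverseʳ i) (+-monoˡ-< (- i) i<j)

<-by : ∀ {x y} e → 0ℤ < e → y ≡ x + e → x < y
<-by {x} e 0<e refl = subst (_< x + e) (+-identityʳ x) (+-monoʳ-< x 0<e)

≤-by : ∀ {x y} e → 0ℤ ≤ e → y ≡ x + e → x ≤ y
≤-by {x} e 0≤e refl = subst (_≤ x + e) (+-identityʳ x) (+-monoʳ-≤ x 0≤e)

<1+⇒≤ : ∀ {i j} → i < 1ℤ + j → i ≤ j
<1+⇒≤ {i} {j} i<1+j = subst (i ≤_) (pred-suc j) (i<j⇒i≤pred[j] i<1+j)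

nonNeg-sum≡0 : ∀ {x y} → 0ℤ ≤ x → 0ℤ ≤ y → x + y ≡ 0ℤ → x ≡ 0ℤ × y ≡ 0ℤ
nonNeg-sum≡0 {+ zero}  {+ zero}  _ _ _  = refl , refl
nonNeg-sum≡0 {+ zero}  {+ suc _} _ _ ()
nonNeg-sum≡0 {+ suc _} {+ _}     _ _ ()

-- x y + z w - 2 = (x′ + y′ + x′ y′) + (z′ + w′ + z′ w′) with x′ = x - 1 etc., a sum of nonnegative terms.
positive-products≡2 : ∀ {x y z w} → 0ℤ < x → 0ℤ < y → 0ℤ < z → 0ℤ < w → x * y + z * w ≡ + 2 →
                      x ≡ 1ℤ × y ≡ 1ℤ × z ≡ 1ℤ × w ≡ 1ℤ
positive-products≡2 {x} {y} {z} {w} 0<x 0<y 0<z 0<w eq =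
  let (xy≡0 , zw≡0) = nonNeg-sum≡0 (block-nonNeg 0<x 0<y) (block-nonNeg 0<z 0<w) excess≡0
      (x′y′≡0 , _)  = nonNeg-sum≡0 (sum-nonNeg 0<x 0<y) (product-nonNeg 0<x 0<y) xy≡0
      (z′w′≡0 , _)  = nonNeg-sum≡0 (sum-nonNeg 0<z 0<w) (product-nonNeg 0<z 0<w) zw≡0
      (x′≡0 , y′≡0) = nonNeg-sum≡0 (0<⇒0≤-1 0<x) (0<⇒0≤-1 0<y) x′y′≡0
      (z′≡0 , w′≡0) = nonNeg-sum≡0 (0<⇒0≤-1 0<z) (0<⇒0≤-1 0<w) z′w′≡0
  in unshift x′≡0 , unshift y′≡0 , unshift z′≡0 , unshift w′≡0
  where
  excess≡0 : ((x - 1ℤ) + (y - 1ℤ) + (x - 1ℤ) * (y - 1ℤ)) + ((z - 1ℤ) + (w - 1ℤ) + (z - 1ℤ) * (w - 1ℤ)) ≡ 0ℤ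
  excess≡0 = begin
    (x - 1ℤ) + (y - 1ℤ) + (x - 1ℤ) * (y - 1ℤ) + ((z - 1ℤ) + (w - 1ℤ) + (z - 1ℤ) * (w - 1ℤ)) ≡⟨ solve (x ∷ y ∷ z ∷ w ∷ []) ⟩
    x * y + z * w - + 2                                                                 ≡⟨ cong (_- + 2) eq ⟩
    0ℤ                                                                                  ∎
    where open ≡-Reasoning
  sum-nonNeg : ∀ {a b} → 0ℤ < a → 0ℤ < b → 0ℤ ≤ (a - 1ℤ) + (b - 1ℤ)
  sum-nonNeg 0<a 0<b = +-mono-≤ (0<⇒0≤-1 0<a) (0<⇒0≤-1 0<b)
  product-nonNeg : ∀ {a b} → 0ℤ < a → 0ℤ < b → 0ℤ ≤ (a - 1ℤ) * (b - 1ℤ)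
  product-nonNeg 0<a 0<b = 0≤-* (0<⇒0≤-1 0<a) (0<⇒0≤-1 0<b)
  block-nonNeg : ∀ {a b} → 0ℤ < a → 0ℤ < b → 0ℤ ≤ (a - 1ℤ) + (b - 1ℤ) + (a - 1ℤ) * (b - 1ℤ)
  block-nonNeg 0<a 0<b = +-mono-≤ (sum-nonNeg 0<a 0<b) (product-nonNeg 0<a 0<b)
  unshift : ∀ {a} → a - 1ℤ ≡ 0ℤ → a ≡ 1ℤ
  unshift {a} eq′ = trans (a ≡ a - 1ℤ + 1ℤ ∋ solve (a ∷ [])) (cong (_+ 1ℤ) eq′)

even-pos⇒2≤ : ∀ {e} → Even e → 0ℤ < e → + 2 ≤ e
even-pos⇒2≤ (+ zero   , refl) (+<+ ())
even-pos⇒2≤ (+ suc t  , refl) _ = subst (+ 2 ≤_) (pos-* 2 (suc t)) (+≤+ (ℕP.*-monoʳ-≤ 2 (ℕ.s≤s ℕ.z≤n)))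
even-pos⇒2≤ (-[1+ t ] , refl) ()

odd-gap : ∀ {x y} → Odd′ x → Odd′ y → x < y → x + + 2 ≤ y
odd-gap {x} {y} odd-x odd-y x<y =
  subst (x + + 2 ≤_) (x + (y - x) ≡ y ∋ solve (x ∷ y ∷ []))
        (+-monoʳ-≤ x (even-pos⇒2≤ (Odd′-+-Odd′ odd-y (Odd′-neg odd-x)) (i<j⇒0<j-i x<y)))

odd-squeeze : ∀ {a b} → Odd′ a → Odd′ b → a < b + + 2 → b < a + + 2 → a ≡ b
odd-squeeze {a} {b} odd-a odd-b a<b+2 b<a+2 with <-cmp a b
... | tri≈ _ a≡b _ = a≡b
... | tri< a<b _ _ = ⊥-elim (<⇒≱ b<a+2 (odd-gap odd-a odd-b a<b))
... | tri> _ _ b<a = ⊥-elim (<⇒≱ a<b+2 (odd-gap odd-b odd-a b<a))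

Bezout : ℤ → ℤ → Set
Bezout p q = ∃[ u ] ∃[ v ] u * p + v * q ≡ 1ℤ

Bezout-sym : ∀ {p q} → Bezout p q → Bezout q p
Bezout-sym {p} {q} (u , v , eq) = v , u , trans (+-comm (v * q) (u * p)) eq

Bezout-∣ : ∀ {p q k} → Bezout p q → q Signed.∣ k * p → q Signed.∣ k
Bezout-∣ {p} {q} {k} (u , v , eq) q∣kp =
  subst (q Signed.∣_) k≡ (Signed.∣m∣n⇒∣m+n (Signed.∣n⇒∣m*n u q∣kp) (Signed.∣n⇒∣m*n (k * v) (Signed.∣-refl {q})))
  where
  k≡ : u * (k * p) + k * v * q ≡ k
  k≡ = begin
    u * (k * p) + k * v * q ≡⟨ solve (u ∷ k ∷ p ∷ v ∷ q ∷ []) ⟩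
    k * (u * p + v * q)     ≡⟨ cong (k *_) eq ⟩
    k * 1ℤ                  ≡⟨ *-identityʳ k ⟩
    k                       ∎
    where open ≡-Reasoning

/ℕ-unique : ∀ n t r d → 0ℤ ≤ r → r < + suc d → n ≡ r + t * + suc d → n /ℕ suc d ≡ t
/ℕ-unique n t r d 0≤r r<q refl = ≤-antisym (<1+⇒≤ F<1+t) (<1+⇒≤ t<1+F)
  where
  q = + suc d
  F = (r + t * q) /ℕ suc d
  F<1+t : F < 1ℤ + t
  F<1+t = *-cancelʳ-<-nonNeg q (≤-<-trans ([n/ℕd]*d≤n (r + t * q) (suc d))
            (subst (r + t * q <_) (sym (suc-* t q)) (+-monoˡ-< (t * q) r<q)))
  t<1+F : t < 1ℤ + F
  t<1+F = *-cancelʳ-<-nonNeg q (≤-<-trans (≤-by r 0≤r (+-comm r (t * q))) (n<s[n/ℕd]*d (r + t * q) (suc d)))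

/ℕ-+-* : ∀ n m d → (n + m * + suc d) /ℕ suc d ≡ n /ℕ suc d + m
/ℕ-+-* n m d = /ℕ-unique _ _ (+ (n %ℕ suc d)) d (+≤+ ℕ.z≤n) (+<+ (n%ℕd<d n (suc d))) (begin
    n + m * q                      ≡⟨ cong (_+ m * q) (a≡a%ℕn+[a/ℕn]*n n (suc d)) ⟩
    + (n %ℕ suc d) + F * q + m * q ≡⟨ regroup (+ (n %ℕ suc d)) F m q ⟩
    + (n %ℕ suc d) + (F + m) * q   ∎)
  where
  open ≡-Reasoning
  q = + suc d
  F = n /ℕ suc d
  regroup : ∀ r F m q → r + F * q + m * q ≡ r + (F + m) * q
  regroup = solve-∀

/ℕ-neg : ∀ n d → n %ℕ suc d ≢ 0 → (- n) /ℕ suc d ≡ - (n /ℕ suc d) - 1ℤ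
/ℕ-neg n d r≢0 with n %ℕ suc d | n%ℕd<d n (suc d) | a≡a%ℕn+[a/ℕn]*n n (suc d)
... | zero   | _   | _  = ⊥-elim (r≢0 refl)
... | suc r₀ | r<q | n≡ = /ℕ-unique _ _ (q - r) d (i≤j⇒0≤j-i (+≤+ (ℕP.<⇒≤ r<q))) (<-by r (0<1+n r₀) (q≡q-r+r q r))
                           (trans (cong -_ n≡) (negated r (n /ℕ suc d) q))
  where
  q = + suc d
  r = + suc r₀
  q≡q-r+r : ∀ q r → q ≡ q - r + r
  q≡q-r+r = solve-∀
  negated : ∀ r F q → - (r + F * q) ≡ q - r + (- F - 1ℤ) * q
  negated = solve-∀

sumTo : (ℕ → ℤ) → ℕ → ℤ
sumTo f zero    = 0ℤ
sumTo f (suc n) = sumTo f n + f (suc n)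

sumℤ-∷ʳ : ∀ xs y → sumℤ (xs ∷ʳ y) ≡ sumℤ xs + y
sumℤ-∷ʳ []       y = trans (+-identityʳ y) (sym (+-identityˡ y))
sumℤ-∷ʳ (x ∷ xs) y = trans (cong (_+_ x) (sumℤ-∷ʳ xs y)) (sym (+-assoc x (sumℤ xs) y))

sumℤ-map-upTo : ∀ f n → sumℤ (map f (map suc (upTo n))) ≡ sumTo f n
sumℤ-map-upTo f zero    = refl
sumℤ-map-upTo f (suc n) = begin
  sumℤ (map f (map suc (upTo (suc n))))        ≡⟨ cong (sumℤ ∘ map f ∘ map suc) (sym (List.applyUpTo-∷ʳ id n)) ⟩
  sumℤ (map f (map suc (upTo n ∷ʳ n)))         ≡⟨ cong (sumℤ ∘ map f) (List.map-++ suc (upTo n) (n ∷ [])) ⟩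
  sumℤ (map f (map suc (upTo n) ∷ʳ suc n))     ≡⟨ cong sumℤ (List.map-++ f (map suc (upTo n)) (suc n ∷ [])) ⟩
  sumℤ (map f (map suc (upTo n)) ∷ʳ f (suc n)) ≡⟨ sumℤ-∷ʳ (map f (map suc (upTo n))) (f (suc n)) ⟩
  sumℤ (map f (map suc (upTo n))) + f (suc n)  ≡⟨ cong (_+ f (suc n)) (sumℤ-map-upTo f n) ⟩
  sumTo f (suc n)                              ∎
  where open ≡-Reasoning

sumTo-cong : ∀ {f g} n → (∀ k → 1 ℕ.≤ k → k ℕ.≤ n → f k ≡ g k) → sumTo f n ≡ sumTo g n
sumTo-cong zero    f≗g = refl
sumTo-cong (suc n) f≗g =
  cong₂ _+_ (sumTo-cong n (λ k 1≤k k≤n → f≗g k 1≤k (ℕP.m≤n⇒m≤1+n k≤n))) (f≗g (suc n) (ℕ.s≤s ℕ.z≤n) ℕP.≤-refl)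

sumTo-zero : ∀ n → sumTo (λ _ → 0ℤ) n ≡ 0ℤ
sumTo-zero zero    = refl
sumTo-zero (suc n) = cong (_+ 0ℤ) (sumTo-zero n)

sumTo-neg : ∀ f n → sumTo (λ k → - f k) n ≡ - sumTo f n
sumTo-neg f zero    = refl
sumTo-neg f (suc n) = trans (cong (_+ - f (suc n)) (sumTo-neg f n)) (sym (neg-distrib-+ (sumTo f n) (f (suc n))))

sumTo-+ : ∀ f g n → sumTo (λ k → f k + g k) n ≡ sumTo f n + sumTo g n
sumTo-+ f g zero    = refl
sumTo-+ f g (suc n) = trans (cong (_+ (f (suc n) + g (suc n))) (sumTo-+ f g n)) (+-interchange (sumTo f n) (sumTo g n) (f (suc n)) (g (suc n)))
  where
  +-interchange : ∀ a b c d → a + b + (c + d) ≡ a + c + (b + d)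
  +-interchange = solve-∀

sumTo-*ˡ : ∀ c f n → sumTo (λ k → c * f k) n ≡ c * sumTo f n
sumTo-*ˡ c f zero    = sym (*-zeroʳ c)
sumTo-*ˡ c f (suc n) = trans (cong (_+ c * f (suc n)) (sumTo-*ˡ c f n)) (sym (*-distribˡ-+ c (sumTo f n) (f (suc n))))

sumTo-swap : ∀ (f : ℕ → ℕ → ℤ) m n → sumTo (λ k → sumTo (f k) n) m ≡ sumTo (λ j → sumTo (λ k → f k j) m) n
sumTo-swap f zero    n = sym (sumTo-zero n)
sumTo-swap f (suc m) n = trans (cong (_+ sumTo (f (suc m)) n) (sumTo-swap f m n))
                               (sym (sumTo-+ (λ j → sumTo (λ k → f k j) m) (f (suc m)) n))

𝟙[_<_] : ℕ → ℕ → ℤ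
𝟙[ m < n ] = if ⌊ m ℕ.<? n ⌋ then 1ℤ else 0ℤ

𝟙[<]-yes : ∀ {m n} → m ℕ.< n → 𝟙[ m < n ] ≡ 1ℤ
𝟙[<]-yes {m} {n} m<n with m ℕ.<? n
... | yes _   = refl
... | no  m≮n = ⊥-elim (m≮n m<n)

𝟙[<]-no : ∀ {m n} → ¬ m ℕ.< n → 𝟙[ m < n ] ≡ 0ℤ
𝟙[<]-no {m} {n} m≮n with m ℕ.<? n
... | yes m<n = ⊥-elim (m≮n m<n)
... | no  _   = refl

𝟙[<]+𝟙[>] : ∀ {m n} → m ≢ n → 𝟙[ m < n ] + 𝟙[ n < m ] ≡ 1ℤ
𝟙[<]+𝟙[>] {m} {n} m≢n with ℕP.<-cmp m n
... | tri< m<n _ n≮m = cong₂ _+_ (𝟙[<]-yes m<n) (𝟙[<]-no n≮m)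
... | tri≈ _ m≡n _   = ⊥-elim (m≢n m≡n)
... | tri> m≮n _ n<m = cong₂ _+_ (𝟙[<]-no m≮n) (𝟙[<]-yes n<m)

sumTo-truncate : ∀ g {m} n → m ℕ.≤ n → sumTo (λ j → 𝟙[ j < suc m ] * g j) n ≡ sumTo g m
sumTo-truncate g zero    ℕ.z≤n = refl
sumTo-truncate g {m} (suc n) m≤1+n with ℕP.m≤n⇒m<n∨m≡n m≤1+n
... | inj₂ refl          = sumTo-cong (suc n) (λ k _ k≤1+n → trans (cong (_* g k) (𝟙[<]-yes (ℕ.s≤s k≤1+n))) (*-identityˡ (g k)))
... | inj₁ (ℕ.s≤s m≤n) = begin
  sumTo (λ j → 𝟙[ j < suc m ] * g j) n + 𝟙[ suc n < suc m ] * g (suc n) ≡⟨ cong₂ _+_ (sumTo-truncate g n m≤n)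
                                                                            (cong (_* g (suc n)) (𝟙[<]-no (ℕP.≤⇒≯ (ℕ.s≤s m≤n)))) ⟩
  sumTo g m + 0ℤ                                                         ≡⟨ +-identityʳ (sumTo g m) ⟩
  sumTo g m                                                              ∎
  where open ≡-Reasoning

negOnePowℕ : ℕ → ℤ
negOnePowℕ zero          = 1ℤ
negOnePowℕ (suc zero)    = -1ℤ
negOnePowℕ (suc (suc n)) = negOnePowℕ n

negOnePowℕ-suc : ∀ n → negOnePowℕ (suc n) ≡ - negOnePowℕ n
negOnePowℕ-suc zero          = refl
negOnePowℕ-suc (suc zero)    = refl
negOnePowℕ-suc (suc (suc n)) = negOnePowℕ-suc n

negOnePowℕ-+ : ∀ m n → negOnePowℕ (m ℕ.+ n) ≡ negOnePowℕ m * negOnePowℕ n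
negOnePowℕ-+ zero    n = sym (*-identityˡ (negOnePowℕ n))
negOnePowℕ-+ (suc m) n = begin
  negOnePowℕ (suc m ℕ.+ n)            ≡⟨ negOnePowℕ-suc (m ℕ.+ n) ⟩
  - negOnePowℕ (m ℕ.+ n)              ≡⟨ cong -_ (negOnePowℕ-+ m n) ⟩
  - (negOnePowℕ m * negOnePowℕ n)     ≡⟨ neg-distribˡ-* (negOnePowℕ m) (negOnePowℕ n) ⟩
  - negOnePowℕ m * negOnePowℕ n       ≡⟨ cong (_* negOnePowℕ n) (sym (negOnePowℕ-suc m)) ⟩
  negOnePowℕ (suc m) * negOnePowℕ n   ∎
  where open ≡-Reasoning

negOnePow-pos : ∀ n → negOnePow (+ n) ≡ negOnePowℕ n
negOnePow-pos zero          = refl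
negOnePow-pos (suc zero)    = refl
negOnePow-pos (suc (suc n)) = trans (cong negOnePow (trans (pos-+ 2 n) (+-comm (+ 2) (+ n))))
                                    (trans (negOnePow-+-even (+ n) (Even-2* 1ℤ)) (negOnePow-pos n))

altSum : ℕ → ℤ
altSum = sumTo negOnePowℕ

negOnePowℕ≡1+2*altSum : ∀ n → negOnePowℕ n ≡ 1ℤ + + 2 * altSum n
negOnePowℕ≡1+2*altSum zero    = refl
negOnePowℕ≡1+2*altSum (suc n) = begin
  negOnePowℕ (suc n)                                  ≡⟨ negOnePowℕ-suc n ⟩
  - negOnePowℕ n                                      ≡⟨ cong -_ (negOnePowℕ≡1+2*altSum n) ⟩
  - (1ℤ + + 2 * altSum n)                              ≡⟨ step (altSum n) ⟩
  1ℤ + + 2 * (altSum n + - (1ℤ + + 2 * altSum n))      ≡⟨ cong (λ s → 1ℤ + + 2 * (altSum n + s)) (sym previous) ⟩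
  1ℤ + + 2 * altSum (suc n)                           ∎
  where
  open ≡-Reasoning
  previous : negOnePowℕ (suc n) ≡ - (1ℤ + + 2 * altSum n)
  previous = trans (negOnePowℕ-suc n) (cong -_ (negOnePowℕ≡1+2*altSum n))
  step : ∀ s → - (1ℤ + + 2 * s) ≡ 1ℤ + + 2 * (s + - (1ℤ + + 2 * s))
  step = solve-∀

altSum-+2 : ∀ n → altSum (suc (suc n)) ≡ altSum n
altSum-+2 n = trans (cong (λ s → altSum n + s + negOnePowℕ n) (negOnePowℕ-suc n)) (cancel (altSum n) (negOnePowℕ n))
  where
  cancel : ∀ a b → a + - b + b ≡ a
  cancel = solve-∀

-- altSum takes the values 0 and -1 only, so this says exactly one of altSum m, altSum n is 0.
altSum-odd : ∀ m n → negOnePowℕ (m ℕ.+ n) ≡ -1ℤ → altSum m + altSum n + + 2 * (altSum m * altSum n) ≡ -1ℤ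
altSum-odd (suc (suc m)) n          odd = trans (cong (λ s → s + altSum n + + 2 * (s * altSum n)) (altSum-+2 m)) (altSum-odd m n odd)
altSum-odd zero          (suc (suc n)) odd = trans (cong (λ s → altSum 0 + s + + 2 * (altSum 0 * s)) (altSum-+2 n)) (altSum-odd 0 n odd)
altSum-odd (suc zero)    (suc (suc n)) odd = trans (cong (λ s → altSum 1 + s + + 2 * (altSum 1 * s)) (altSum-+2 n)) (altSum-odd 1 n odd)
altSum-odd zero          zero          ()
altSum-odd zero          (suc zero)    _  = refl
altSum-odd (suc zero)    zero          _  = refl
altSum-odd (suc zero)    (suc zero)    ()

-- The sum 𝔖: periodicity, oddness and reciprocity

frakS-term : ℤ → ℕ → ℕ → ℤ
frakS-term p q₀ k = negOnePow ((+ k * p) /ℕ suc q₀ + + k + 1ℤ)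

frakS≡sumTo : ∀ p q₀ → frakS p (+ suc q₀) ≡ sumTo (frakS-term p q₀) q₀
frakS≡sumTo p q₀ = sumℤ-map-upTo (frakS-term p q₀) q₀

frakS-periodic : ∀ p M q₀ → frakS (p + M * (+ 2 * + suc q₀)) (+ suc q₀) ≡ frakS p (+ suc q₀)
frakS-periodic p M q₀ = begin
  frakS (p + M * (+ 2 * q)) q                  ≡⟨ frakS≡sumTo (p + M * (+ 2 * q)) q₀ ⟩
  sumTo (frakS-term (p + M * (+ 2 * q)) q₀) q₀ ≡⟨ sumTo-cong q₀ (λ k _ _ → term≡ k) ⟩
  sumTo (frakS-term p q₀) q₀                   ≡⟨ sym (frakS≡sumTo p q₀) ⟩
  frakS p q                                    ∎
  where
  open ≡-Reasoning
  q = + suc q₀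
  expand : ∀ k p M q → k * (p + M * (+ 2 * q)) ≡ k * p + + 2 * (k * M) * q
  expand = solve-∀
  reorder : ∀ F e k → F + e + k + 1ℤ ≡ F + k + 1ℤ + e
  reorder = solve-∀
  term≡ : ∀ k → frakS-term (p + M * (+ 2 * q)) q₀ k ≡ frakS-term p q₀ k
  term≡ k = begin
    negOnePow ((+ k * (p + M * (+ 2 * q))) /ℕ suc q₀ + + k + 1ℤ)
      ≡⟨ cong (λ n → negOnePow (n /ℕ suc q₀ + + k + 1ℤ)) (expand (+ k) p M q) ⟩
    negOnePow ((+ k * p + + 2 * (+ k * M) * q) /ℕ suc q₀ + + k + 1ℤ)
      ≡⟨ cong (λ F → negOnePow (F + + k + 1ℤ)) (/ℕ-+-* (+ k * p) (+ 2 * (+ k * M)) q₀) ⟩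
    negOnePow ((+ k * p) /ℕ suc q₀ + + 2 * (+ k * M) + + k + 1ℤ)
      ≡⟨ cong negOnePow (reorder ((+ k * p) /ℕ suc q₀) (+ 2 * (+ k * M)) (+ k)) ⟩
    negOnePow ((+ k * p) /ℕ suc q₀ + + k + 1ℤ + + 2 * (+ k * M))
      ≡⟨ negOnePow-+-even ((+ k * p) /ℕ suc q₀ + + k + 1ℤ) (Even-2* (+ k * M)) ⟩
    negOnePow ((+ k * p) /ℕ suc q₀ + + k + 1ℤ)
      ∎

kp%q≢0 : ∀ {p q₀ k} → Bezout p (+ suc q₀) → 1 ℕ.≤ k → k ℕ.≤ q₀ → (+ k * p) %ℕ suc q₀ ≢ 0
kp%q≢0 {p} {q₀} {k} bez 1≤k k≤q₀ r≡0 = ℕP.≤⇒≯ k≤q₀ (ℕDiv.∣⇒≤ ⦃ ℕ.>-nonZero 1≤k ⦄ (Signed.∣⇒∣ᵤ {+ suc q₀} {+ k} q∣k))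
  where
  F = (+ k * p) /ℕ suc q₀
  kp≡ : + k * p ≡ + ((+ k * p) %ℕ suc q₀) + F * + suc q₀
  kp≡ = a≡a%ℕn+[a/ℕn]*n (+ k * p) (suc q₀)
  q∣k : + suc q₀ Signed.∣ + k
  q∣k = Bezout-∣ bez (Signed.divides F
          (trans kp≡ (trans (cong (λ r → + r + F * + suc q₀) r≡0) (+-identityˡ (F * + suc q₀)))))

frakS-neg : ∀ p q₀ → Bezout p (+ suc q₀) → frakS (- p) (+ suc q₀) ≡ - frakS p (+ suc q₀)
frakS-neg p q₀ bez = begin
  frakS (- p) (+ suc q₀)             ≡⟨ frakS≡sumTo (- p) q₀ ⟩
  sumTo (frakS-term (- p) q₀) q₀     ≡⟨ sumTo-cong q₀ term≡ ⟩
  sumTo (λ k → - frakS-term p q₀ k) q₀ ≡⟨ sumTo-neg (frakS-term p q₀) q₀ ⟩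
  - sumTo (frakS-term p q₀) q₀       ≡⟨ cong -_ (sym (frakS≡sumTo p q₀)) ⟩
  - frakS p (+ suc q₀)               ∎
  where
  open ≡-Reasoning
  reorder : ∀ F k → - F - 1ℤ + k + 1ℤ ≡ - (F + k + 1ℤ) + 1ℤ + + 2 * k
  reorder = solve-∀
  term≡ : ∀ k → 1 ℕ.≤ k → k ℕ.≤ q₀ → frakS-term (- p) q₀ k ≡ - frakS-term p q₀ k
  term≡ k 1≤k k≤q₀ = begin
    negOnePow ((+ k * - p) /ℕ suc q₀ + + k + 1ℤ)    ≡⟨ cong (λ n → negOnePow (n /ℕ suc q₀ + + k + 1ℤ)) (sym (neg-distribʳ-* (+ k) p)) ⟩
    negOnePow ((- (+ k * p)) /ℕ suc q₀ + + k + 1ℤ)  ≡⟨ cong (λ F → negOnePow (F + + k + 1ℤ)) (/ℕ-neg (+ k * p) q₀ (kp%q≢0 bez 1≤k k≤q₀)) ⟩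
    negOnePow (- F - 1ℤ + + k + 1ℤ)                 ≡⟨ cong negOnePow (reorder F (+ k)) ⟩
    negOnePow (- E + 1ℤ + + 2 * + k)                ≡⟨ negOnePow-+-even (- E + 1ℤ) (Even-2* (+ k)) ⟩
    negOnePow (- E + 1ℤ)                            ≡⟨ negOnePow-suc (- E) ⟩
    - negOnePow (- E)                               ≡⟨ cong -_ (negOnePow-neg E) ⟩
    - negOnePow E                                   ∎
    where
    F = (+ k * p) /ℕ suc q₀
    E = F + + k + 1ℤ

-- (-1)^⌊kp/q⌋ is rewritten as 1 + 2 Σ_{j ≤ p₀, jq < kp} (-1)^j; in D the lattice points (j, k) with 1 ≤ j < p,
-- 1 ≤ k < q are split by the sign of jq - kp, which never vanishes since p and q are coprime.
module Reciprocity (p₀ q₀ : ℕ) (bez : Bezout (+ suc p₀) (+ suc q₀)) where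
  p q : ℕ
  p = suc p₀
  q = suc q₀

  F : ℕ → ℕ
  F k = (k ℕ.* p) ℕ./ q

  kp≡ : ∀ k → k ℕ.* p ≡ (k ℕ.* p) ℕ.% q ℕ.+ F k ℕ.* q
  kp≡ k = ℕD.m≡m%n+[m/n]*n (k ℕ.* p) q

  kp%q≢0ℕ : ∀ {k} → 1 ℕ.≤ k → k ℕ.≤ q₀ → (k ℕ.* p) ℕ.% q ≢ 0
  kp%q≢0ℕ {k} 1≤k k≤q₀ = subst (_≢ 0) (cong (_%ℕ q) (sym (pos-* k p))) (kp%q≢0 {k = k} bez 1≤k k≤q₀)

  jq≢kp : ∀ {k} j → 1 ℕ.≤ k → k ℕ.≤ q₀ → j ℕ.* q ≢ k ℕ.* p
  jq≢kp j 1≤k k≤q₀ jq≡kp = kp%q≢0ℕ 1≤k k≤q₀ (trans (cong (ℕ._% q) (sym jq≡kp)) (ℕD.m*n%n≡0 j q))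

  𝟙[jq<kp]≡𝟙[j≤F] : ∀ {k} j → 1 ℕ.≤ k → k ℕ.≤ q₀ → 𝟙[ j ℕ.* q < k ℕ.* p ] ≡ 𝟙[ j < suc (F k) ]
  𝟙[jq<kp]≡𝟙[j≤F] {k} j 1≤k k≤q₀ with j ℕ.<? suc (F k)
  ... | yes (ℕ.s≤s j≤F) = 𝟙[<]-yes (ℕP.≤-<-trans (ℕP.*-monoˡ-≤ q j≤F)
          (subst (F k ℕ.* q ℕ.<_) (sym (kp≡ k)) (ℕP.m<n+m (F k ℕ.* q) (ℕP.n≢0⇒n>0 (kp%q≢0ℕ 1≤k k≤q₀)))))
  ... | no j≰F = 𝟙[<]-no (ℕP.≤⇒≯ (ℕP.≤-trans (ℕP.<⇒≤ kp<[1+F]q) (ℕP.*-monoˡ-≤ q (ℕP.≮⇒≥ j≰F))))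
    where
    kp<[1+F]q : k ℕ.* p ℕ.< suc (F k) ℕ.* q
    kp<[1+F]q = subst (ℕ._< suc (F k) ℕ.* q) (sym (kp≡ k)) (ℕP.+-monoˡ-< (F k ℕ.* q) (ℕD.m%n<n (k ℕ.* p) q))

  F≤p₀ : ∀ k → k ℕ.≤ q₀ → F k ℕ.≤ p₀
  F≤p₀ k k≤q₀ = ℕ.s≤s⁻¹ (ℕP.*-cancelʳ-< q (F k) p (ℕP.≤-<-trans (ℕD.m/n*n≤m (k ℕ.* p) q)
      (subst (k ℕ.* p ℕ.<_) (ℕP.*-comm q p) (ℕP.*-monoˡ-< p (ℕ.s≤s k≤q₀)))))

  frakS-term≡ : ∀ k → frakS-term (+ p) q₀ k ≡ - (negOnePowℕ k * negOnePowℕ (F k))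
  frakS-term≡ k = begin
    negOnePow ((+ k * + p) /ℕ q + + k + 1ℤ) ≡⟨ cong (λ n → negOnePow (n /ℕ q + + k + 1ℤ)) (sym (pos-* k p)) ⟩
    negOnePow (+ F k + + k + 1ℤ)            ≡⟨ cong negOnePow (trans (cong (_+ 1ℤ) (sym (pos-+ (F k) k))) (sym (pos-+ (F k ℕ.+ k) 1))) ⟩
    negOnePow (+ (F k ℕ.+ k ℕ.+ 1))         ≡⟨ negOnePow-pos (F k ℕ.+ k ℕ.+ 1) ⟩
    negOnePowℕ (F k ℕ.+ k ℕ.+ 1)            ≡⟨ negOnePowℕ-+ (F k ℕ.+ k) 1 ⟩
    negOnePowℕ (F k ℕ.+ k) * -1ℤ            ≡⟨ cong (_* -1ℤ) (negOnePowℕ-+ (F k) k) ⟩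
    negOnePowℕ (F k) * negOnePowℕ k * -1ℤ   ≡⟨ flip (negOnePowℕ (F k)) (negOnePowℕ k) ⟩
    - (negOnePowℕ k * negOnePowℕ (F k))     ∎
    where
    open ≡-Reasoning
    flip : ∀ a b → a * b * -1ℤ ≡ - (b * a)
    flip = solve-∀

  below : ℕ → ℤ
  below k = sumTo (λ j → 𝟙[ j ℕ.* q < k ℕ.* p ] * negOnePowℕ j) p₀

  negOnePowℕ-F : ∀ k → 1 ℕ.≤ k → k ℕ.≤ q₀ → negOnePowℕ (F k) ≡ 1ℤ + + 2 * below k
  negOnePowℕ-F k 1≤k k≤q₀ = trans (negOnePowℕ≡1+2*altSum (F k)) (cong (λ s → 1ℤ + + 2 * s)
     (trans (sym (sumTo-truncate negOnePowℕ p₀ (F≤p₀ k k≤q₀)))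
            (sumTo-cong p₀ (λ j _ _ → cong (_* negOnePowℕ j) (sym (𝟙[jq<kp]≡𝟙[j≤F] j 1≤k k≤q₀))))))

  D : ℤ
  D = sumTo (λ k → sumTo (λ j → negOnePowℕ k * (𝟙[ j ℕ.* q < k ℕ.* p ] * negOnePowℕ j)) p₀) q₀

  frakS≡ : frakS (+ p) (+ q) ≡ - (altSum q₀ + + 2 * D)
  frakS≡ = begin
    frakS (+ p) (+ q)                                           ≡⟨ frakS≡sumTo (+ p) q₀ ⟩
    sumTo (frakS-term (+ p) q₀) q₀                              ≡⟨ sumTo-cong q₀ (λ k 1≤k k≤q₀ →
                                                                     trans (frakS-term≡ k) (cong (λ s → - (σ k * s)) (negOnePowℕ-F k 1≤k k≤q₀))) ⟩
    sumTo (λ k → - (σ k * (1ℤ + + 2 * below k))) q₀             ≡⟨ sumTo-neg _ q₀ ⟩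
    - sumTo (λ k → σ k * (1ℤ + + 2 * below k)) q₀               ≡⟨ cong -_ (sumTo-cong q₀ (λ k _ _ → distrib (σ k) (below k))) ⟩
    - sumTo (λ k → σ k + + 2 * (σ k * below k)) q₀              ≡⟨ cong -_ (sumTo-+ σ _ q₀) ⟩
    - (altSum q₀ + sumTo (λ k → + 2 * (σ k * below k)) q₀)      ≡⟨ cong (λ s → - (altSum q₀ + s)) (sumTo-*ˡ (+ 2) _ q₀) ⟩
    - (altSum q₀ + + 2 * sumTo (λ k → σ k * below k) q₀)        ≡⟨ cong (λ s → - (altSum q₀ + + 2 * s))
                                                                     (sumTo-cong q₀ (λ k _ _ → sym (sumTo-*ˡ (σ k) _ p₀))) ⟩
    - (altSum q₀ + + 2 * D)                                     ∎
    where
    open ≡-Reasoning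
    σ = negOnePowℕ
    distrib : ∀ s y → s * (1ℤ + + 2 * y) ≡ s + + 2 * (s * y)
    distrib = solve-∀

D-reciprocity : ∀ p₀ q₀ (bez : Bezout (+ suc p₀) (+ suc q₀)) →
                Reciprocity.D p₀ q₀ bez + Reciprocity.D q₀ p₀ (Bezout-sym bez) ≡ altSum q₀ * altSum p₀
D-reciprocity p₀ q₀ bez = begin
  D₁ + D₂
    ≡⟨ cong (_+_ D₁) (sumTo-swap (λ j k → σ j * (𝟙[ k ℕ.* p < j ℕ.* q ] * σ k)) p₀ q₀) ⟩
  D₁ + sumTo (λ k → sumTo (λ j → σ j * (𝟙[ k ℕ.* p < j ℕ.* q ] * σ k)) p₀) q₀
    ≡⟨ sym (sumTo-+ _ _ q₀) ⟩
  sumTo (λ k → sumTo (λ j → σ k * (𝟙[ j ℕ.* q < k ℕ.* p ] * σ j)) p₀ + sumTo (λ j → σ j * (𝟙[ k ℕ.* p < j ℕ.* q ] * σ k)) p₀) q₀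
    ≡⟨ sumTo-cong q₀ (λ k 1≤k k≤q₀ → trans (sym (sumTo-+ _ _ p₀)) (sumTo-cong p₀ (λ j _ _ → paired k j 1≤k k≤q₀))) ⟩
  sumTo (λ k → sumTo (λ j → σ k * σ j) p₀) q₀
    ≡⟨ sumTo-cong q₀ (λ k _ _ → trans (sumTo-*ˡ (σ k) σ p₀) (*-comm (σ k) (altSum p₀))) ⟩
  sumTo (λ k → altSum p₀ * σ k) q₀
    ≡⟨ sumTo-*ˡ (altSum p₀) σ q₀ ⟩
  altSum p₀ * altSum q₀
    ≡⟨ *-comm (altSum p₀) (altSum q₀) ⟩
  altSum q₀ * altSum p₀ ∎
  where
  open ≡-Reasoning
  p = suc p₀
  q = suc q₀
  σ = negOnePowℕ
  D₁ = Reciprocity.D p₀ q₀ bez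
  D₂ = Reciprocity.D q₀ p₀ (Bezout-sym bez)
  factor : ∀ s t x y → s * (x * t) + t * (y * s) ≡ s * t * (x + y)
  factor = solve-∀
  paired : ∀ k j → 1 ℕ.≤ k → k ℕ.≤ q₀ →
           σ k * (𝟙[ j ℕ.* q < k ℕ.* p ] * σ j) + σ j * (𝟙[ k ℕ.* p < j ℕ.* q ] * σ k) ≡ σ k * σ j
  paired k j 1≤k k≤q₀ = begin
    σ k * (𝟙[ j ℕ.* q < k ℕ.* p ] * σ j) + σ j * (𝟙[ k ℕ.* p < j ℕ.* q ] * σ k)
      ≡⟨ factor (σ k) (σ j) 𝟙[ j ℕ.* q < k ℕ.* p ] 𝟙[ k ℕ.* p < j ℕ.* q ] ⟩
    σ k * σ j * (𝟙[ j ℕ.* q < k ℕ.* p ] + 𝟙[ k ℕ.* p < j ℕ.* q ])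
      ≡⟨ cong (σ k * σ j *_) (𝟙[<]+𝟙[>] (Reciprocity.jq≢kp p₀ q₀ bez j 1≤k k≤q₀)) ⟩
    σ k * σ j * 1ℤ
      ≡⟨ *-identityʳ (σ k * σ j) ⟩
    σ k * σ j ∎

frakS-reciprocity : ∀ p₀ q₀ → Bezout (+ suc p₀) (+ suc q₀) → Odd′ (+ suc p₀ + + suc q₀) →
                    frakS (+ suc p₀) (+ suc q₀) + frakS (+ suc q₀) (+ suc p₀) ≡ 1ℤ
frakS-reciprocity p₀ q₀ bez odd = begin
  frakS (+ p) (+ q) + frakS (+ q) (+ p) ≡⟨ cong₂ _+_ (Reciprocity.frakS≡ p₀ q₀ bez) (Reciprocity.frakS≡ q₀ p₀ (Bezout-sym bez)) ⟩
  - (A + + 2 * D₁) + - (B + + 2 * D₂)   ≡⟨ regroup A B D₁ D₂ ⟩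
  - (A + B + + 2 * (D₁ + D₂))           ≡⟨ cong (λ D → - (A + B + + 2 * D)) (D-reciprocity p₀ q₀ bez) ⟩
  - (A + B + + 2 * (A * B))             ≡⟨ cong -_ (altSum-odd q₀ p₀ odd-sum) ⟩
  1ℤ                                    ∎
  where
  open ≡-Reasoning
  p = suc p₀
  q = suc q₀
  A = altSum q₀
  B = altSum p₀
  D₁ = Reciprocity.D p₀ q₀ bez
  D₂ = Reciprocity.D q₀ p₀ (Bezout-sym bez)
  regroup : ∀ A B D₁ D₂ → - (A + + 2 * D₁) + - (B + + 2 * D₂) ≡ - (A + B + + 2 * (D₁ + D₂))
  regroup = solve-∀
  odd-sum : negOnePowℕ (q₀ ℕ.+ p₀) ≡ -1ℤ
  odd-sum = begin
    negOnePowℕ (q₀ ℕ.+ p₀)   ≡⟨ cong (negOnePowℕ ∘ suc) (trans (cong suc (ℕP.+-comm q₀ p₀)) (sym (ℕP.+-suc p₀ q₀))) ⟩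
    negOnePowℕ (p ℕ.+ q)     ≡⟨ sym (negOnePow-pos (p ℕ.+ q)) ⟩
    negOnePow (+ (p ℕ.+ q))  ≡⟨ cong negOnePow (pos-+ p q) ⟩
    negOnePow (+ p + + q)    ≡⟨ negOnePow-odd odd ⟩
    -1ℤ                      ∎

-- The net 𝒩_θ and crossings of the vertical geodesic from i∞ to p/q

record NetEdge (a c b d : ℤ) : Set where
  field
    0<c   : 0ℤ < c
    0<d   : 0ℤ < d
    odd-a : Odd′ a
    odd-b : Odd′ b
    odd-c : Odd′ c
    odd-d : Odd′ d
    det   : a * d - b * c ≡ - + 2

det⇒bc≡ad+2 : ∀ {a b c d} → a * d - b * c ≡ - + 2 → b * c ≡ a * d + + 2
det⇒bc≡ad+2 {a} {b} {c} {d} det = begin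
  b * c                   ≡⟨ solve (a ∷ b ∷ c ∷ d ∷ []) ⟩
  a * d - (a * d - b * c) ≡⟨ cong (λ x → a * d - x) det ⟩
  a * d - - + 2           ≡⟨ solve (a ∷ d ∷ []) ⟩
  a * d + + 2             ∎
  where open ≡-Reasoning

∣odd∧∣2⇒≡1 : ∀ n {a} → + n Signed.∣ a → + n Signed.∣ + 2 → Odd′ a → n ≡ 1
∣odd∧∣2⇒≡1 n n∣a n∣2 odd with ℕDiv.∣⇒≤ {2} {n} (Signed.∣⇒∣ᵤ n∣2)
∣odd∧∣2⇒≡1 zero                _                     n∣2 _   | _ with ℕDiv.0∣⇒≡0 (Signed.∣⇒∣ᵤ n∣2)
... | ()
∣odd∧∣2⇒≡1 (suc zero)          _                     _   _   | _ = refl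
∣odd∧∣2⇒≡1 (suc (suc zero))    (Signed.divides t eq) _   odd | _ = ⊥-elim (¬Even∧Odd′ (t , trans eq (*-comm t (+ 2))) odd)
∣odd∧∣2⇒≡1 (suc (suc (suc n))) _                     _   _   | ℕ.s≤s (ℕ.s≤s ())

gcd≡1 : ∀ {a c} u v → Odd′ a → u * a + v * c ≡ + 2 → gcd a c ≡ 1ℤ
gcd≡1 {a} {c} u v odd eq = cong +_ (∣odd∧∣2⇒≡1 g g∣a g∣2 odd)
  where
  g = ℕGCD.gcd ∣ a ∣ ∣ c ∣
  g∣a : + g Signed.∣ a
  g∣a = Signed.∣ᵤ⇒∣ {+ g} {a} (gcd[i,j]∣i a c)
  g∣c : + g Signed.∣ c
  g∣c = Signed.∣ᵤ⇒∣ {+ g} {c} (gcd[i,j]∣j a c)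
  g∣2 : + g Signed.∣ + 2
  g∣2 = subst (+ g Signed.∣_) eq (Signed.∣m∣n⇒∣m+n (Signed.∣n⇒∣m*n u g∣a) (Signed.∣n⇒∣m*n v g∣c))

NetEdge⇒IsNet : ∀ {a c b d} → NetEdge a c b d → IsNet (a , c , b , d)
NetEdge⇒IsNet {a} {c} {b} {d} e =
  0<c , 0<d , gcd≡1 {a} {c} (- d) b odd-a (trans (- d * a + b * c ≡ b * c - a * d ∋ solve (a ∷ b ∷ c ∷ d ∷ [])) bc-ad≡2) ,
  gcd≡1 {b} {d} c (- a) odd-b (trans (c * b + - a * d ≡ b * c - a * d ∋ solve (a ∷ b ∷ c ∷ d ∷ [])) bc-ad≡2) ,
  Odd′⇒Odd {a} odd-a , Odd′⇒Odd {b} odd-b , Odd′⇒Odd {c} odd-c , Odd′⇒Odd {d} odd-d , inj₂ det ,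
  <-by (+ 2) (0<1+n 1) bc≡ad+2
  where
  open NetEdge e
  bc-ad≡2 : b * c - a * d ≡ + 2
  bc≡ad+2 : b * c ≡ a * d + + 2
  bc≡ad+2 = det⇒bc≡ad+2 {a} {b} {c} {d} det
  bc-ad≡2 = trans (cong (_- a * d) bc≡ad+2) (a * d + + 2 - a * d ≡ + 2 ∋ solve (a ∷ d ∷ []))

IsNet⇒NetEdge : ∀ {a c b d} → IsNet (a , c , b , d) → NetEdge a c b d
IsNet⇒NetEdge {a} {c} {b} {d} (0<c , 0<d , _ , _ , odd-a , odd-b , odd-c , odd-d , det± , ad<bc) = record
  { 0<c = 0<c ; 0<d = 0<d ; odd-a = Odd⇒Odd′ odd-a ; odd-b = Odd⇒Odd′ odd-b ; odd-c = Odd⇒Odd′ odd-c ; odd-d = Odd⇒Odd′ odd-d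
  ; det = det-2 det± }
  where
  det-2 : (a * d - b * c ≡ + 2) ⊎ (a * d - b * c ≡ - + 2) → a * d - b * c ≡ - + 2
  det-2 (inj₂ det) = det
  det-2 (inj₁ det) = ⊥-elim (<-asym ad<bc (<-by (+ 2) (0<1+n 1) (begin
    a * d                   ≡⟨ solve (a ∷ b ∷ c ∷ d ∷ []) ⟩
    b * c + (a * d - b * c) ≡⟨ cong (_+_ (b * c)) det ⟩
    b * c + + 2             ∎)))
    where open ≡-Reasoning

Crosses : ℤ → ℕ → Geod → Set
Crosses p q (a , c , b , d) = a * + q < p * c × p * d < b * + q

NetCrossing : ℤ → ℕ → Geod → Set
NetCrossing p q g = IsNet g × Crosses p q g

ListsCrossing : ℤ → ℕ → List Geod → Set
ListsCrossing p q L = Unique L × All (NetCrossing p q) L × (∀ g → IsNet g → Crosses p q g → g ∈ L)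

orientation : Geod → ℤ
orientation (a , c , b , d) = orientSign c d

orientationSum : List Geod → ℤ
orientationSum L = sumℤ (map orientation L)

Crosses⇒0<b : ∀ {x q a c b d} → 0ℤ < x → 0ℤ < + q → 0ℤ < d → Crosses x q (a , c , b , d) → 0ℤ < b
Crosses⇒0<b 0<x 0<q 0<d (_ , right) = 0<*⇒0< 0<q (<-trans (0<-* 0<x 0<d) right)

φ-crossing : ∀ p q g → Crosses p q g → φ p q g ≡ orientation g
φ-crossing p q (a , c , b , d) (left , right) with a * + q ℤ.<? p * c | p * d ℤ.<? b * + q
... | yes _ | yes _   = refl
... | no ¬left | _    = ⊥-elim (¬left left)
... | yes _ | no ¬right = ⊥-elim (¬right right)

φ-not-crossing : ∀ p q g → ¬ Crosses p q g → φ p q g ≡ 0ℤ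
φ-not-crossing p q (a , c , b , d) ¬crosses with a * + q ℤ.<? p * c | p * d ℤ.<? b * + q
... | yes left | yes right = ⊥-elim (¬crosses (left , right))
... | no _     | _         = refl
... | yes _    | no _      = refl

crosses? : ∀ p q g → Dec (Crosses p q g)
crosses? p q (a , c , b , d) = (a * + q ℤ.<? p * c) ×-dec (p * d ℤ.<? b * + q)

sumℤ-φ : ∀ p q L → All (NetCrossing p q) L → sumℤ (map (φ p q) L) ≡ orientationSum L
sumℤ-φ p q []       All.[]                   = refl
sumℤ-φ p q (g ∷ L) ((_ , crosses) All.∷ gs) = cong₂ _+_ (φ-crossing p q g crosses) (sumℤ-φ p q L gs)

ListsCrossing⇒IθIs : ∀ {p q L n} → ListsCrossing p q L → orientationSum L ≡ n → IθIs p q n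
ListsCrossing⇒IθIs {p} {q} {L} (unique , crossing , complete) sum≡n =
  L , unique , All.map proj₁ crossing , complete′ , trans (sumℤ-φ p q L crossing) sum≡n
  where
  complete′ : ∀ g → IsNet g → φ p q g ≢ 0ℤ → g ∈ L
  complete′ g net φ≢0 with crosses? p q g
  ... | yes crosses = complete g net crosses
  ... | no ¬crosses = ⊥-elim (φ≢0 (φ-not-crossing p q g ¬crosses))

ListsCrossing-map : ∀ {p q p′ q′} (f f⁻¹ : Geod → Geod) → (∀ g → f⁻¹ (f g) ≡ g) → (∀ g → f (f⁻¹ g) ≡ g) →
                    (∀ g → NetCrossing p q g → NetCrossing p′ q′ (f g)) →
                    (∀ g → NetCrossing p′ q′ g → NetCrossing p q (f⁻¹ g)) →
                    ∀ {L} → ListsCrossing p q L → ListsCrossing p′ q′ (map f L)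
ListsCrossing-map {p′ = p′} {q′} f f⁻¹ f⁻¹∘f f∘f⁻¹ forth back {L} (unique , crossing , complete) =
  Unique.map⁺ f-injective unique , All.map⁺ (All.map (forth _) crossing) , complete′
  where
  f-injective : ∀ {g h} → f g ≡ f h → g ≡ h
  f-injective {g} {h} eq = trans (sym (f⁻¹∘f g)) (trans (cong f⁻¹ eq) (f⁻¹∘f h))
  complete′ : ∀ g → IsNet g → Crosses p′ q′ g → g ∈ map f L
  complete′ g net crosses =
    let (net′ , crosses′) = back g (net , crosses)
    in subst (_∈ map f L) (f∘f⁻¹ g) (∈-map⁺ f (complete (f⁻¹ g) net′ crosses′))

orientationSum-map : ∀ f → (∀ g → orientation (f g) ≡ orientation g) → ∀ L → orientationSum (map f L) ≡ orientationSum L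
orientationSum-map f keeps []      = refl
orientationSum-map f keeps (g ∷ L) = cong₂ _+_ (keeps g) (orientationSum-map f keeps L)

-- The maps x ↦ x + 2M, x ↦ -x and x ↦ 1/x on the net

translate : ℤ → Geod → Geod
translate M (a , c , b , d) = (a + M * (+ 2 * c) , c , b + M * (+ 2 * d) , d)

translate-cancel : ∀ M N → M + N ≡ 0ℤ → ∀ g → translate N (translate M g) ≡ g
translate-cancel M N M+N≡0 (a , c , b , d) = cong₂ (λ a′ b′ → (a′ , c , b′ , d)) (cancel a c) (cancel b d)
  where
  cancel : ∀ a c → a + M * (+ 2 * c) + N * (+ 2 * c) ≡ a
  cancel a c = begin
    a + M * (+ 2 * c) + N * (+ 2 * c) ≡⟨ solve (a ∷ M ∷ N ∷ c ∷ []) ⟩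
    a + (M + N) * (+ 2 * c)           ≡⟨ cong (λ s → a + s * (+ 2 * c)) M+N≡0 ⟩
    a + 0ℤ * (+ 2 * c)                ≡⟨ +-identityʳ a ⟩
    a                                 ∎
    where open ≡-Reasoning

translate-NetCrossing : ∀ {p p′ q} M → p′ ≡ p + M * (+ 2 * + q) → ∀ g → NetCrossing p q g → NetCrossing p′ q (translate M g)
translate-NetCrossing {p} {p′} {q} M refl (a , c , b , d) (net , left , right) =
  NetEdge⇒IsNet edge′ , <-by _ (i<j⇒0<j-i left) (shifted p M (+ q) a c) , <-by _ (i<j⇒0<j-i right) (shifted′ p M (+ q) b d)
  where
  open NetEdge (IsNet⇒NetEdge {a} {c} {b} {d} net)
  edge′ : NetEdge (a + M * (+ 2 * c)) c (b + M * (+ 2 * d)) d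
  edge′ = record
    { 0<c = 0<c ; 0<d = 0<d ; odd-c = odd-c ; odd-d = odd-d
    ; odd-a = subst Odd′ (cong (_+_ a) (+ 2 * (M * c) ≡ M * (+ 2 * c) ∋ solve (M ∷ c ∷ []))) (Odd′-+-Even odd-a (Even-2* (M * c)))
    ; odd-b = subst Odd′ (cong (_+_ b) (+ 2 * (M * d) ≡ M * (+ 2 * d) ∋ solve (M ∷ d ∷ []))) (Odd′-+-Even odd-b (Even-2* (M * d)))
    ; det = trans ((a + M * (+ 2 * c)) * d - (b + M * (+ 2 * d)) * c ≡ a * d - b * c ∋ solve (a ∷ b ∷ c ∷ d ∷ M ∷ [])) det }
  shifted : ∀ p M Q a c → (p + M * (+ 2 * Q)) * c ≡ (a + M * (+ 2 * c)) * Q + (p * c - a * Q)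
  shifted = solve-∀
  shifted′ : ∀ p M Q b d → (b + M * (+ 2 * d)) * Q ≡ (p + M * (+ 2 * Q)) * d + (b * Q - p * d)
  shifted′ = solve-∀

ListsCrossing-translate : ∀ {p q} M {L} → ListsCrossing p q L → ListsCrossing (p + M * (+ 2 * + q)) q (map (translate M) L)
ListsCrossing-translate {p} {q} M = ListsCrossing-map {p} {q} {p′} {q} (translate M) (translate (- M))
  (translate-cancel M (- M) (+-inverseʳ M)) (translate-cancel (- M) M (+-inverseˡ M))
  (translate-NetCrossing {p} {p′} {q} M refl) (translate-NetCrossing {p′} {p} {q} (- M) (undo p M (+ q)))
  where
  p′ = p + M * (+ 2 * + q)
  undo : ∀ p M Q → p ≡ p + M * (+ 2 * Q) + - M * (+ 2 * Q)
  undo = solve-∀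

orientationSum-translate : ∀ M L → orientationSum (map (translate M) L) ≡ orientationSum L
orientationSum-translate M = orientationSum-map (translate M) (λ _ → refl)

reflect : Geod → Geod
reflect (a , c , b , d) = (- b , d , - a , c)

reflect-involutive : ∀ g → reflect (reflect g) ≡ g
reflect-involutive (a , c , b , d) = cong₂ (λ a′ b′ → (a′ , c , b′ , d)) (neg-involutive a) (neg-involutive b)

reflect-NetCrossing : ∀ {p p′ q} → p′ ≡ - p → ∀ g → NetCrossing p q g → NetCrossing p′ q (reflect g)
reflect-NetCrossing {p} {p′} {q} refl (a , c , b , d) (net , left , right) =
  NetEdge⇒IsNet edge′ ,
  subst₂ _<_ (neg-distribˡ-* b (+ q)) (neg-distribˡ-* p d) (neg-mono-< right) ,
  subst₂ _<_ (neg-distribˡ-* p c) (neg-distribˡ-* a (+ q)) (neg-mono-< left)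
  where
  open NetEdge (IsNet⇒NetEdge {a} {c} {b} {d} net)
  edge′ : NetEdge (- b) d (- a) c
  edge′ = record
    { 0<c = 0<d ; 0<d = 0<c ; odd-a = Odd′-neg odd-b ; odd-b = Odd′-neg odd-a ; odd-c = odd-d ; odd-d = odd-c
    ; det = trans (- b * c - - a * d ≡ a * d - b * c ∋ solve (a ∷ b ∷ c ∷ d ∷ [])) det }

ListsCrossing-reflect : ∀ {p q L} → ListsCrossing p q L → ListsCrossing (- p) q (map reflect L)
ListsCrossing-reflect {p} {q} = ListsCrossing-map {p} {q} { - p} {q} reflect reflect reflect-involutive reflect-involutive
  (reflect-NetCrossing {p} { - p} {q} refl) (reflect-NetCrossing { - p} {p} {q} (sym (neg-involutive p)))

orientSign-swap : ∀ c d → orientSign d c ≡ - orientSign c d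
orientSign-swap c d with c ℤ.<? d | d ℤ.<? c
... | yes c<d | yes d<c = ⊥-elim (<-asym c<d d<c)
... | yes _   | no _    = refl
... | no _    | yes _   = refl
... | no _    | no _    = refl

orientationSum-reflect : ∀ L → orientationSum (map reflect L) ≡ - orientationSum L
orientationSum-reflect []                  = refl
orientationSum-reflect ((a , c , b , d) ∷ L) =
  trans (cong₂ _+_ (orientSign-swap c d) (orientationSum-reflect L)) (sym (neg-distrib-+ (orientSign c d) (orientationSum L)))

invert : Geod → Geod
invert (a , c , b , d) = (d , b , c , a)

e₀ : Geod
e₀ = (-1ℤ , 1ℤ , 1ℤ , 1ℤ)

e₀-NetEdge : NetEdge -1ℤ 1ℤ 1ℤ 1ℤ
e₀-NetEdge = record
  { 0<c = 0<1+n 0 ; 0<d = 0<1+n 0 ; odd-a = Odd′-neg Odd′-1 ; odd-b = Odd′-1 ; odd-c = Odd′-1 ; odd-d = Odd′-1 ; det = refl }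

invert-NetEdge : ∀ {a c b d} → NetEdge a c b d → 0ℤ < a → 0ℤ < b → NetEdge d b c a
invert-NetEdge {a} {c} {b} {d} e 0<a 0<b = record
  { 0<c = 0<b ; 0<d = 0<a ; odd-a = odd-d ; odd-b = odd-c ; odd-c = odd-b ; odd-d = odd-a
  ; det = trans (d * a - c * b ≡ a * d - b * c ∋ solve (a ∷ b ∷ c ∷ d ∷ [])) det }
  where open NetEdge e

-- bc + (-a)d = 2 with all four factors positive forces them to be 1.
NetEdge-nonPos⇒e₀ : ∀ {a c b d} → NetEdge a c b d → ¬ 0ℤ < a → 0ℤ < b → (a , c , b , d) ≡ e₀
NetEdge-nonPos⇒e₀ {a} {c} {b} {d} e a≯0 0<b
  with positive-products≡2 0<b 0<c 0<-a 0<d (trans (b * c + - a * d ≡ - (a * d - b * c) ∋ solve (a ∷ b ∷ c ∷ d ∷ [])) (cong -_ det))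
  where
  open NetEdge e
  0<-a : 0ℤ < - a
  0<-a with <-cmp 0ℤ a
  ... | tri< 0<a _ _ = ⊥-elim (a≯0 0<a)
  ... | tri≈ _ 0≡a _ = ⊥-elim (Odd′⇒≢0 odd-a (sym 0≡a))
  ... | tri> _ _ a<0 = neg-mono-< a<0
... | refl , refl , -a≡1 , refl = cong (_, 1ℤ , 1ℤ , 1ℤ) (trans (sym (neg-involutive a)) (cong -_ -a≡1))

Crosses-invert : ∀ p q {g} → Crosses (+ p) q g → Crosses (+ q) p (invert g)
Crosses-invert p q {a , c , b , d} (left , right) =
  subst₂ _<_ (*-comm (+ p) d) (*-comm b (+ q)) right , subst₂ _<_ (*-comm a (+ q)) (*-comm (+ p) c) left

orientSign-< : ∀ {c d} → c < d → orientSign c d ≡ -1ℤ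
orientSign-< {c} {d} c<d with c ℤ.<? d
... | yes _   = refl
... | no c≮d = ⊥-elim (c≮d c<d)

orientSign-> : ∀ {c d} → d < c → orientSign c d ≡ 1ℤ
orientSign-> {c} {d} d<c with c ℤ.<? d | d ℤ.<? c
... | yes c<d | _       = ⊥-elim (<-asym c<d d<c)
... | no _    | yes _   = refl
... | no _    | no d≮c = ⊥-elim (d≮c d<c)

integral : Geod → ℤ
integral (a , c , b , d) = if ⌊ c ℤ.≟ 1ℤ ⌋ ∧ ⌊ d ℤ.≟ 1ℤ ⌋ then 1ℤ else 0ℤ

integral-≢ : ∀ {a c b d} → c ≢ d → integral (a , c , b , d) ≡ 0ℤ
integral-≢ {a} {c} {b} {d} c≢d with c ℤ.≟ 1ℤ | d ℤ.≟ 1ℤ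
... | yes c≡1 | yes d≡1 = ⊥-elim (c≢d (trans c≡1 (sym d≡1)))
... | yes _   | no _    = refl
... | no _    | _       = refl

integral≢0 : ∀ {a c b d} → integral (a , c , b , d) ≢ 0ℤ → c ≡ 1ℤ × d ≡ 1ℤ
integral≢0 {a} {c} {b} {d} ≢0 with c ℤ.≟ 1ℤ | d ℤ.≟ 1ℤ
... | yes c≡1 | yes d≡1 = c≡1 , d≡1
... | yes _   | no _    = ⊥-elim (≢0 refl)
... | no _    | _       = ⊥-elim (≢0 refl)

NetEdge-c<d⇒a<b : ∀ {a c b d} → NetEdge a c b d → 0ℤ < a → c < d → a < b
NetEdge-c<d⇒a<b {a} {c} {b} {d} e 0<a c<d with a ℤ.<? b
... | yes a<b = a<b
... | no a≮b  = ⊥-elim (<-asym (<-by (+ 2) (0<1+n 1) (det⇒bc≡ad+2 {a} {b} {c} {d} det)) bc<ad)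
  where
  open NetEdge e
  bc<ad : b * c < a * d
  bc<ad = ≤-<-trans (*-monoʳ-≤-nonNeg c ⦃ nonNegative (<⇒≤ 0<c) ⦄ (≮⇒≥ a≮b)) (*-monoˡ-<-pos a ⦃ positive 0<a ⦄ c<d)

-- If a ≤ b, then 0 = bc - ad - 2 = b (c - d - 2) + (b - a) d + 2 (b - 1) > 0, using c ≥ d + 2 for odd c > d.
NetEdge-d<c⇒b<a : ∀ {a c b d} → NetEdge a c b d → 0ℤ < b → d < b → d < c → b < a
NetEdge-d<c⇒b<a {a} {c} {b} {d} e 0<b d<b d<c with b ℤ.<? a
... | yes b<a = b<a
... | no b≮a  = ⊥-elim (<⇒≢ 0<sum (sym sum≡0))
  where
  open NetEdge e
  0≤c-d-2 : 0ℤ ≤ c - d - + 2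
  0≤c-d-2 = subst (0ℤ ≤_) (c - (d + + 2) ≡ c - d - + 2 ∋ solve (c ∷ d ∷ [])) (i≤j⇒0≤j-i (odd-gap odd-d odd-c d<c))
  0<b-1 : 0ℤ < b - 1ℤ
  0<b-1 = subst (0ℤ <_) (b - d + (d - 1ℤ) ≡ b - 1ℤ ∋ solve (b ∷ d ∷ [])) (+-mono-<-≤ (i<j⇒0<j-i d<b) (0<⇒0≤-1 0<d))
  0<sum : 0ℤ < b * (c - d - + 2) + (b - a) * d + + 2 * (b - 1ℤ)
  0<sum = +-mono-≤-< (+-mono-≤ (0≤-* (<⇒≤ 0<b) 0≤c-d-2) (0≤-* (i≤j⇒0≤j-i (≮⇒≥ b≮a)) (<⇒≤ 0<d))) (0<-* (0<1+n 1) 0<b-1)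
  sum≡0 : b * (c - d - + 2) + (b - a) * d + + 2 * (b - 1ℤ) ≡ 0ℤ
  sum≡0 = begin
    b * (c - d - + 2) + (b - a) * d + + 2 * (b - 1ℤ) ≡⟨ solve (a ∷ b ∷ c ∷ d ∷ []) ⟩
    - (a * d - b * c) - + 2                          ≡⟨ cong (λ x → - x - + 2) det ⟩
    0ℤ                                               ∎
    where open ≡-Reasoning

-- (b - a) c = 2 and c is odd.
NetEdge-c≡d⇒c≡1 : ∀ {a c b} → NetEdge a c b c → c ≡ 1ℤ
NetEdge-c≡d⇒c≡1 {a} {c} {b} e = trans (sym +∣c∣≡c) (cong +_ (∣odd∧∣2⇒≡1 ∣ c ∣ ∣c∣∣c ∣c∣∣2 odd-c))
  where
  open NetEdge e
  +∣c∣≡c : + ∣ c ∣ ≡ c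
  +∣c∣≡c = 0≤i⇒+∣i∣≡i (<⇒≤ 0<c)
  ∣c∣∣c : + ∣ c ∣ Signed.∣ c
  ∣c∣∣c = Signed.∣m∣∣m
  ∣c∣∣2 : + ∣ c ∣ Signed.∣ + 2
  ∣c∣∣2 = subst (Signed._∣ + 2) (sym +∣c∣≡c) (Signed.divides (b - a) (begin
    + 2               ≡⟨ cong -_ (sym det) ⟩
    - (a * c - b * c) ≡⟨ solve (a ∷ b ∷ c ∷ []) ⟩
    (b - a) * c       ∎))
    where open ≡-Reasoning

orientation-invert : ∀ {a c b d} → NetEdge a c b d → 0ℤ < a → 0ℤ < b → d < b →
                     orientation (a , c , b , d) + orientation (invert (a , c , b , d)) ≡ integral (a , c , b , d)
orientation-invert {a} {c} {b} {d} e 0<a 0<b d<b with <-cmp c d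
... | tri< c<d _ _ = trans (cong₂ _+_ (orientSign-< c<d) (orientSign-> (NetEdge-c<d⇒a<b e 0<a c<d)))
                           (sym (integral-≢ {a} {c} {b} {d} (<⇒≢ c<d)))
... | tri> _ _ d<c = trans (cong₂ _+_ (orientSign-> d<c) (orientSign-< (NetEdge-d<c⇒b<a e 0<b d<b d<c)))
                           (sym (integral-≢ {a} {c} {b} {d} (λ c≡d → <⇒≢ d<c (sym c≡d))))
... | tri≈ _ refl _ with NetEdge-c≡d⇒c≡1 e
...   | refl = cong (_+_ 0ℤ) (orientSign-> (<-by (+ 2) (0<1+n 1) (trans (sym (*-identityʳ b)) b≡a+2)))
  where
  b≡a+2 : b * 1ℤ ≡ a + + 2
  b≡a+2 = trans (det⇒bc≡ad+2 {a} {b} {1ℤ} {1ℤ} (NetEdge.det e)) (cong (_+ + 2) (*-identityʳ a))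

between-odd : ∀ q p₀ → Odd′ (q + + suc p₀) → ∃[ A ] Odd′ A × A * + suc p₀ < q × q < (A + + 2) * + suc p₀
between-odd q p₀ odd with (q - + suc p₀) %ℕ (2 ℕ.* suc p₀) | n%ℕd<d (q - + suc p₀) (2 ℕ.* suc p₀)
                        | a≡a%ℕn+[a/ℕn]*n (q - + suc p₀) (2 ℕ.* suc p₀)
... | zero   | _    | q-p≡ = ⊥-elim (¬Even∧Odd′ (_ , even q (+ suc p₀) t q-p≡) odd)
  where
  t = (q - + suc p₀) /ℕ (2 ℕ.* suc p₀)
  even : ∀ q p t → q - p ≡ + 0 + t * (+ 2 * p) → q + p ≡ + 2 * (t * p + p)
  even q p t q-p≡ = begin
    q + p                        ≡⟨ solve (q ∷ p ∷ []) ⟩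
    q - p + + 2 * p              ≡⟨ cong (_+ + 2 * p) q-p≡ ⟩
    + 0 + t * (+ 2 * p) + + 2 * p ≡⟨ solve (t ∷ p ∷ []) ⟩
    + 2 * (t * p + p)            ∎
    where open ≡-Reasoning
... | suc r₀ | r<2p | q-p≡ =
  + 2 * t + 1ℤ , (t , refl) , <-by (+ suc r₀) (0<1+n r₀) (below q (+ suc p₀) (+ suc r₀) t q-p≡) ,
  <-by (+ 2 * + suc p₀ - + suc r₀) (i<j⇒0<j-i (+<+ r<2p)) (above q (+ suc p₀) (+ suc r₀) t q-p≡)
  where
  t = (q - + suc p₀) /ℕ (2 ℕ.* suc p₀)
  below : ∀ q p r t → q - p ≡ r + t * (+ 2 * p) → q ≡ (+ 2 * t + 1ℤ) * p + r
  below q p r t q-p≡ = begin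
    q                        ≡⟨ solve (q ∷ p ∷ []) ⟩
    q - p + p                ≡⟨ cong (_+ p) q-p≡ ⟩
    r + t * (+ 2 * p) + p    ≡⟨ solve (r ∷ t ∷ p ∷ []) ⟩
    (+ 2 * t + 1ℤ) * p + r   ∎
    where open ≡-Reasoning
  above : ∀ q p r t → q - p ≡ r + t * (+ 2 * p) → (+ 2 * t + 1ℤ + + 2) * p ≡ q + (+ 2 * p - r)
  above q p r t q-p≡ = begin
    (+ 2 * t + 1ℤ + + 2) * p        ≡⟨ solve (r ∷ t ∷ p ∷ []) ⟩
    r + t * (+ 2 * p) + p + (+ 2 * p - r) ≡⟨ cong (λ x → x + p + (+ 2 * p - r)) (sym q-p≡) ⟩
    q - p + p + (+ 2 * p - r)       ≡⟨ solve (q ∷ p ∷ r ∷ []) ⟩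
    q + (+ 2 * p - r)               ∎
    where open ≡-Reasoning

sumℤ-map-+ : ∀ {A : Set} (f h : A → ℤ) xs → sumℤ (map (λ x → f x + h x) xs) ≡ sumℤ (map f xs) + sumℤ (map h xs)
sumℤ-map-+ f h []       = refl
sumℤ-map-+ f h (x ∷ xs) =
  trans (cong (_+_ (f x + h x)) (sumℤ-map-+ f h xs)) (+-interchange (f x) (h x) (sumℤ (map f xs)) (sumℤ (map h xs)))
  where
  +-interchange : ∀ a b c d → a + b + (c + d) ≡ a + c + (b + d)
  +-interchange = solve-∀

sumℤ-map-cong : ∀ {A : Set} {P : A → Set} {f h : A → ℤ} → (∀ {x} → P x → f x ≡ h x) →
                ∀ {xs} → All P xs → sumℤ (map f xs) ≡ sumℤ (map h xs)
sumℤ-map-cong f≗h All.[]         = refl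
sumℤ-map-cong f≗h (px All.∷ pxs) = cong₂ _+_ (f≗h px) (sumℤ-map-cong f≗h pxs)

sumℤ-map-zero : ∀ {A : Set} (f : A → ℤ) {xs} → All (λ x → f x ≡ 0ℤ) xs → sumℤ (map f xs) ≡ 0ℤ
sumℤ-map-zero f All.[]            = refl
sumℤ-map-zero f (fx≡0 All.∷ fxs≡0) = cong₂ _+_ fx≡0 (sumℤ-map-zero f fxs≡0)

sumℤ-map-single : ∀ {A : Set} (f : A → ℤ) {s xs} → Unique xs → s ∈ xs → (∀ {x} → x ∈ xs → x ≢ s → f x ≡ 0ℤ) →
                  sumℤ (map f xs) ≡ f s
sumℤ-map-single f {s} {x ∷ xs} (x∉xs AllPairs.∷ unique) (here refl) vanish =
  trans (cong (_+_ (f x)) (sumℤ-map-zero f (All.tabulate (λ x′∈ → vanish (there x′∈) (λ eq → All.lookup x∉xs x′∈ (sym eq))))))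
        (+-identityʳ (f x))
sumℤ-map-single f {s} {x ∷ xs} (x∉xs AllPairs.∷ unique) (there s∈xs) vanish =
  trans (cong₂ _+_ (vanish (here refl) (All.lookup x∉xs s∈xs)) (sumℤ-map-single f unique s∈xs (vanish ∘ there)))
        (+-identityˡ (f s))

module Inversion (p₀ q : ℕ) (p<q : suc p₀ ℕ.< q) where
  p : ℕ
  p = suc p₀

  0<q : 0ℤ < + q
  0<q = <-trans (0<1+n p₀) (+<+ p<q)

  e₀-not-crossing : ¬ Crosses (+ q) p e₀
  e₀-not-crossing (_ , right) = <-asym (+<+ p<q) (subst₂ _<_ (*-identityʳ (+ q)) (*-identityˡ (+ p)) right)

  crossing-positive : ∀ {a c b d} → NetEdge a c b d → Crosses (+ q) p (a , c , b , d) → 0ℤ < a × 0ℤ < b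
  crossing-positive {a} {c} {b} {d} e crosses = 0<a , 0<b
    where
    0<b : 0ℤ < b
    0<b = Crosses⇒0<b {a = a} 0<q (0<1+n p₀) (NetEdge.0<d e) crosses
    0<a : 0ℤ < a
    0<a with 0ℤ ℤ.<? a
    ... | yes 0<a = 0<a
    ... | no a≯0  = ⊥-elim (e₀-not-crossing (subst (Crosses (+ q) p) (NetEdge-nonPos⇒e₀ e a≯0 0<b) crosses))

  e₀⊎crossing-positive : ∀ {a c b d} → NetEdge a c b d → Crosses (+ p) q (a , c , b , d) →
                         (a , c , b , d) ≡ e₀ ⊎ (0ℤ < a × 0ℤ < b)
  e₀⊎crossing-positive {a} {c} {b} {d} e crosses with 0ℤ ℤ.<? a | Crosses⇒0<b {a = a} (0<1+n p₀) 0<q (NetEdge.0<d e) crosses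
  ... | yes 0<a | 0<b = inj₂ (0<a , 0<b)
  ... | no a≯0  | 0<b = inj₁ (NetEdge-nonPos⇒e₀ e a≯0 0<b)

  NetCrossing-invert : ∀ g → NetCrossing (+ q) p g → NetCrossing (+ p) q (invert g)
  NetCrossing-invert (a , c , b , d) (net , crosses) =
    let e = IsNet⇒NetEdge {a} {c} {b} {d} net
        (0<a , 0<b) = crossing-positive e crosses
    in NetEdge⇒IsNet (invert-NetEdge e 0<a 0<b) , Crosses-invert q p crosses

  e₀-crossing : NetCrossing (+ p) q e₀
  e₀-crossing = NetEdge⇒IsNet e₀-NetEdge ,
    subst₂ _<_ (sym (-1*i≡-i (+ q))) (sym (*-identityʳ (+ p))) (<-trans (neg-mono-< 0<q) (0<1+n p₀)) ,
    subst₂ _<_ (sym (*-identityʳ (+ p))) (sym (*-identityˡ (+ q))) (+<+ p<q)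

  invert≢e₀ : ∀ g → NetCrossing (+ q) p g → invert g ≢ e₀
  invert≢e₀ (a , c , b , d) (net , _) eq =
    <-asym (NetEdge.0<d (IsNet⇒NetEdge {a} {c} {b} {d} net)) (subst (_< 0ℤ) (sym (cong proj₁ eq)) -<+)

  ListsCrossing-invert : ∀ {L} → ListsCrossing (+ q) p L → ListsCrossing (+ p) q (e₀ ∷ map invert L)
  ListsCrossing-invert {L} (unique , crossing , complete) =
    All.map⁺ (All.map (λ {g} crosses eq → invert≢e₀ g crosses (sym eq)) crossing) AllPairs.∷ Unique.map⁺ (cong invert) unique ,
    e₀-crossing All.∷ All.map⁺ (All.map (NetCrossing-invert _) crossing) ,
    complete′
    where
    complete′ : ∀ g → IsNet g → Crosses (+ p) q g → g ∈ e₀ ∷ map invert L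
    complete′ (a , c , b , d) net crosses with e₀⊎crossing-positive (IsNet⇒NetEdge {a} {c} {b} {d} net) crosses
    ... | inj₁ ≡e₀ = here ≡e₀
    ... | inj₂ (0<a , 0<b) = there (∈-map⁺ invert (complete (d , b , c , a)
            (NetEdge⇒IsNet (invert-NetEdge (IsNet⇒NetEdge {a} {c} {b} {d} net) 0<a 0<b)) (Crosses-invert p q crosses)))

  orientation-invert-crossing : ∀ g → NetCrossing (+ q) p g → orientation g + orientation (invert g) ≡ integral g
  orientation-invert-crossing (a , c , b , d) (net , left , right) = orientation-invert e 0<a 0<b d<b
    where
    e = IsNet⇒NetEdge {a} {c} {b} {d} net
    0<a = proj₁ (crossing-positive e (left , right))
    0<b = proj₂ (crossing-positive e (left , right))
    d<b : d < b
    d<b = *-cancelʳ-<-nonNeg (+ q) (subst (_< b * + q) (*-comm (+ q) d) (<-trans right (*-monoˡ-<-pos b ⦃ positive 0<b ⦄ (+<+ p<q))))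

  module _ {A} (odd-A : Odd′ A) (Ap<q : A * + p < + q) (q<[A+2]p : + q < (A + + 2) * + p) where
    integral-edge : Geod
    integral-edge = (A , 1ℤ , A + + 2 , 1ℤ)

    integral-edge-crossing : NetCrossing (+ q) p integral-edge
    integral-edge-crossing =
      NetEdge⇒IsNet edge ,
      subst (A * + p <_) (sym (*-identityʳ (+ q))) Ap<q ,
      subst (_< (A + + 2) * + p) (sym (*-identityʳ (+ q))) q<[A+2]p
      where
      det-A : ∀ A → A * 1ℤ - (A + + 2) * 1ℤ ≡ - + 2
      det-A = solve-∀
      edge : NetEdge A 1ℤ (A + + 2) 1ℤ
      edge = record
        { 0<c = 0<1+n 0 ; 0<d = 0<1+n 0 ; odd-a = odd-A ; odd-b = Odd′-+-Even odd-A (Even-2* 1ℤ) ; odd-c = Odd′-1 ; odd-d = Odd′-1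
        ; det = det-A A }

    integral-edge-unique : ∀ g → NetCrossing (+ q) p g → integral g ≢ 0ℤ → g ≡ integral-edge
    integral-edge-unique (a , c , b , d) (net , left , right) ≢0 with integral≢0 {a} {c} {b} {d} ≢0
    ... | refl , refl = cong₂ (λ a′ b′ → (a′ , 1ℤ , b′ , 1ℤ)) a≡A (trans b≡a+2 (cong (_+ + 2) a≡A))
      where
      open NetEdge (IsNet⇒NetEdge {a} {1ℤ} {b} {1ℤ} net)
      b≡a+2 : b ≡ a + + 2
      b≡a+2 = begin
        b             ≡⟨ sym (*-identityʳ b) ⟩
        b * 1ℤ        ≡⟨ det⇒bc≡ad+2 {a} {b} {1ℤ} {1ℤ} det ⟩
        a * 1ℤ + + 2  ≡⟨ cong (_+ + 2) (*-identityʳ a) ⟩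
        a + + 2       ∎
        where open ≡-Reasoning
      crossing-A = proj₂ integral-edge-crossing
      a<A+2 : a < A + + 2
      a<A+2 = *-cancelʳ-<-nonNeg (+ p) (<-trans left (proj₂ crossing-A))
      A<a+2 : A < a + + 2
      A<a+2 = *-cancelʳ-<-nonNeg (+ p) (<-trans (proj₁ crossing-A) (subst (λ x → + q * 1ℤ < x * + p) b≡a+2 right))
      a≡A : a ≡ A
      a≡A = odd-squeeze odd-a odd-A a<A+2 A<a+2

    orientationSum-invert : ∀ {L} → ListsCrossing (+ q) p L → orientationSum (e₀ ∷ map invert L) ≡ 1ℤ - orientationSum L
    orientationSum-invert {L} (unique , crossing , complete) = begin
      orientationSum (e₀ ∷ map invert L)                       ≡⟨ +-identityˡ _ ⟩
      sumℤ (map orientation (map invert L))                    ≡⟨ cong sumℤ (sym (List.map-∘ L)) ⟩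
      S′                                                       ≡⟨ add-subtract S S′ ⟩
      S + S′ - S                                               ≡⟨ cong (_- S) (sym (sumℤ-map-+ orientation (orientation ∘ invert) L)) ⟩
      sumℤ (map (λ g → orientation g + orientation (invert g)) L) - S
                                                               ≡⟨ cong (_- S) (sumℤ-map-cong (λ {g} → orientation-invert-crossing g) crossing) ⟩
      sumℤ (map integral L) - S                                ≡⟨ cong (_- S) (sumℤ-map-single integral unique integral-edge∈L vanish) ⟩
      1ℤ - S                                                   ∎
      where
      open ≡-Reasoning
      add-subtract : ∀ x y → y ≡ x + y - x
      add-subtract = solve-∀
      S = orientationSum L
      S′ = sumℤ (map (orientation ∘ invert) L)
      integral-edge∈L : integral-edge ∈ L
      integral-edge∈L = complete integral-edge (proj₁ integral-edge-crossing) (proj₂ integral-edge-crossing)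
      vanish : ∀ {g} → g ∈ L → g ≢ integral-edge → integral g ≡ 0ℤ
      vanish {g} g∈L g≢ with integral g ℤ.≟ 0ℤ
      ... | yes ≡0 = ≡0
      ... | no ≢0  = ⊥-elim (g≢ (integral-edge-unique g (All.lookup crossing g∈L) ≢0))

-- Euclidean descent

Agree : ℤ → ℕ → Set
Agree p q = ∃[ L ] ListsCrossing p q L × orientationSum L ≡ frakS p (+ q)

Agree⇒IθIs : ∀ {p q} → Agree p q → IθIs p q (frakS p (+ q))
Agree⇒IθIs {p} {q} (L , lists , sum≡) = ListsCrossing⇒IθIs {p} {q} {L} lists sum≡

agree-base : ∀ p → Even p → Agree p 1
agree-base p even = edge ∷ [] , (All.[] AllPairs.∷ AllPairs.[] , crossing All.∷ All.[] , complete) , refl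
  where
  edge : Geod
  edge = (p - 1ℤ , 1ℤ , p + 1ℤ , 1ℤ)
  crossing : NetCrossing p 1 edge
  crossing = NetEdge⇒IsNet (record
      { 0<c = 0<1+n 0 ; 0<d = 0<1+n 0 ; odd-c = Odd′-1 ; odd-d = Odd′-1
      ; odd-a = subst Odd′ (+-comm -1ℤ p) (Odd′-+-Even (Odd′-neg Odd′-1) even)
      ; odd-b = subst Odd′ (+-comm 1ℤ p) (Odd′-+-Even Odd′-1 even)
      ; det = (p - 1ℤ) * 1ℤ - (p + 1ℤ) * 1ℤ ≡ - + 2 ∋ solve (p ∷ []) }) ,
    <-by 1ℤ (0<1+n 0) (p * 1ℤ ≡ (p - 1ℤ) * 1ℤ + 1ℤ ∋ solve (p ∷ [])) ,
    <-by 1ℤ (0<1+n 0) ((p + 1ℤ) * 1ℤ ≡ p * 1ℤ + 1ℤ ∋ solve (p ∷ []))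
  -- c (b - p d) + d (p c - a) = b c - a d = 2 with both brackets positive by crossing.
  complete : ∀ g → IsNet g → Crosses p 1 g → g ∈ edge ∷ []
  complete (a , c , b , d) net (left , right)
    with positive-products≡2 0<c (i<j⇒0<j-i right) 0<d (i<j⇒0<j-i left) (trans (split a b c d) (cong -_ det))
    where
    open NetEdge (IsNet⇒NetEdge {a} {c} {b} {d} net)
    split : ∀ a b c d → c * (b * 1ℤ - p * d) + d * (p * c - a * 1ℤ) ≡ - (a * d - b * c)
    split a b c d = solve (a ∷ b ∷ c ∷ d ∷ p ∷ [])
  ... | refl , b-p≡1 , refl , p-a≡1 = here (cong₂ (λ a′ b′ → (a′ , 1ℤ , b′ , 1ℤ)) (solve-for-a a p-a≡1) (solve-for-b b b-p≡1))
    where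
    solve-for-a : ∀ a → p * 1ℤ - a * 1ℤ ≡ 1ℤ → a ≡ p - 1ℤ
    solve-for-a a eq = begin
      a                             ≡⟨ solve (a ∷ p ∷ []) ⟩
      p - 1ℤ + (1ℤ - (p * 1ℤ - a * 1ℤ)) ≡⟨ cong (λ x → p - 1ℤ + (1ℤ - x)) eq ⟩
      p - 1ℤ + 0ℤ                   ≡⟨ +-identityʳ (p - 1ℤ) ⟩
      p - 1ℤ                        ∎
      where open ≡-Reasoning
    solve-for-b : ∀ b → b * 1ℤ - p * 1ℤ ≡ 1ℤ → b ≡ p + 1ℤ
    solve-for-b b eq = begin
      b                      ≡⟨ solve (b ∷ p ∷ []) ⟩
      p + (b * 1ℤ - p * 1ℤ)  ≡⟨ cong (_+_ p) eq ⟩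
      p + 1ℤ                 ∎
      where open ≡-Reasoning

agree-translate : ∀ {p′} q₀ M {p} → p ≡ p′ + M * (+ 2 * + suc q₀) → Agree p′ (suc q₀) → Agree p (suc q₀)
agree-translate {p′} q₀ M refl (L , lists , sum≡) =
  map (translate M) L , ListsCrossing-translate {p′} {suc q₀} M lists ,
  trans (orientationSum-translate M L) (trans sum≡ (sym (frakS-periodic p′ M q₀)))

agree-reflect : ∀ {p} q₀ → Bezout p (+ suc q₀) → Agree p (suc q₀) → Agree (- p) (suc q₀)
agree-reflect {p} q₀ bez (L , lists , sum≡) =
  map reflect L , ListsCrossing-reflect {p} {suc q₀} lists ,
  trans (orientationSum-reflect L) (trans (cong -_ sum≡) (sym (frakS-neg p q₀ bez)))

agree-invert : ∀ p₀ q₀ → suc p₀ ℕ.< suc q₀ → Bezout (+ suc q₀) (+ suc p₀) → Odd′ (+ suc q₀ + + suc p₀) →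
               Agree (+ suc q₀) (suc p₀) → Agree (+ suc p₀) (suc q₀)
agree-invert p₀ q₀ p<q bez odd (L , lists , sum≡) with between-odd (+ suc q₀) p₀ odd
... | A , odd-A , Ap<q , q<[A+2]p =
  e₀ ∷ map invert L , Inversion.ListsCrossing-invert p₀ (suc q₀) p<q lists , (begin
    orientationSum (e₀ ∷ map invert L) ≡⟨ Inversion.orientationSum-invert p₀ (suc q₀) p<q odd-A Ap<q q<[A+2]p lists ⟩
    1ℤ - orientationSum L              ≡⟨ cong (_-_ 1ℤ) sum≡ ⟩
    1ℤ - S[q,p]                        ≡⟨ cong (_- S[q,p]) (sym reciprocity) ⟩
    S[p,q] + S[q,p] - S[q,p]           ≡⟨ cancel S[p,q] S[q,p] ⟩
    S[p,q]                             ∎)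
  where
  open ≡-Reasoning
  S[p,q] = frakS (+ suc p₀) (+ suc q₀)
  S[q,p] = frakS (+ suc q₀) (+ suc p₀)
  reciprocity : S[p,q] + S[q,p] ≡ 1ℤ
  reciprocity = frakS-reciprocity p₀ q₀ (Bezout-sym bez) (subst Odd′ (+-comm (+ suc q₀) (+ suc p₀)) odd)
  cancel : ∀ x y → x + y - y ≡ x
  cancel = solve-∀

record Descent (p : ℤ) (q₀ : ℕ) : Set where
  constructor descent
  field
    r₀  : ℕ
    M   : ℤ
    r<q : r₀ ℕ.< q₀
    p≡  : p ≡ + suc r₀ + M * (+ 2 * + suc q₀)

Bezout-descend : ∀ {p q r} M → p ≡ r + M * (+ 2 * q) → Bezout p q → Bezout q r
Bezout-descend {p} {q} {r} M refl (u , v , eq) =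
  v + u * M * + 2 , u , trans ((v + u * M * + 2) * q + u * r ≡ u * (r + M * (+ 2 * q)) + v * q ∋ solve (u ∷ v ∷ q ∷ r ∷ M ∷ [])) eq

Odd′-descend : ∀ {p q r} M → p ≡ r + M * (+ 2 * q) → Odd′ (p + q) → Odd′ (q + r)
Odd′-descend {p} {q} {r} M refl odd =
  subst Odd′ (r + M * (+ 2 * q) + q + + 2 * (- (M * q)) ≡ q + r ∋ solve (q ∷ r ∷ M ∷ [])) (Odd′-+-Even odd (Even-2* (- (M * q))))

Bezout-neg : ∀ {p q} → Bezout p q → Bezout (- p) q
Bezout-neg {p} {q} (u , v , eq) = - u , v , trans (- u * - p + v * q ≡ u * p + v * q ∋ solve (u ∷ v ∷ p ∷ q ∷ [])) eq

Bezout-negʳ : ∀ {p q} → Bezout p q → Bezout p (- q)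
Bezout-negʳ {p} {q} (u , v , eq) = u , - v , trans (u * p + - v * - q ≡ u * p + v * q ∋ solve (u ∷ v ∷ p ∷ q ∷ [])) eq

Odd′-neg-+ : ∀ {p q} → Odd′ (p + q) → Odd′ (- p + q)
Odd′-neg-+ {p} {q} odd = subst Odd′ (- (p + q) + + 2 * q ≡ - p + q ∋ solve (p ∷ q ∷ [])) (Odd′-+-Even (Odd′-neg odd) (Even-2* q))

Bezout⇒≢*2q : ∀ {p q₀} F → 1 ℕ.≤ q₀ → Bezout p (+ suc q₀) → p ≢ F * (+ 2 * + suc q₀)
Bezout⇒≢*2q {p} {q₀} F 1≤q₀ bez p≡ = ℕP.<⇒≱ (ℕ.s≤s 1≤q₀) (ℕDiv.∣⇒≤ (Signed.∣⇒∣ᵤ {+ suc q₀} {1ℤ} q∣1))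
  where
  q∣1 : + suc q₀ Signed.∣ 1ℤ
  q∣1 = Bezout-∣ bez (Signed.divides (F * + 2) (trans (*-identityˡ p) (trans p≡ (sym (*-assoc F (+ 2) (+ suc q₀))))))

Odd′⇒≢q+*2q : ∀ {p q} F → Odd′ (p + q) → p ≢ q + F * (+ 2 * q)
Odd′⇒≢q+*2q {p} {q} F odd refl = ¬Even∧Odd′ (q + F * q , (q + F * (+ 2 * q) + q ≡ + 2 * (q + F * q) ∋ solve (q ∷ F ∷ []))) odd

descent-neg : ∀ {p q₀ ρ} F → suc q₀ ℕ.< ρ → ρ ℕ.< 2 ℕ.* suc q₀ → p ≡ + ρ + F * (+ 2 * + suc q₀) → Descent (- p) q₀
descent-neg {p} {q₀} {ρ} F q<ρ ρ<2q p≡ with ℕP.m≤n⇒∃[o]m+o≡n ρ<2q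
... | s₀ , 1+ρ+s₀≡2q = descent s₀ (- F - 1ℤ) s₀<q₀ (begin
    - p                                      ≡⟨ cong -_ p≡ ⟩
    - (+ ρ + F * (+ 2 * q))                  ≡⟨ cong (λ x → - (x + F * (+ 2 * q))) ρ≡ ⟩
    - (+ 2 * q - + suc s₀ + F * (+ 2 * q))   ≡⟨ reflected (+ suc s₀) F q ⟩
    + suc s₀ + (- F - 1ℤ) * (+ 2 * q)        ∎)
  where
  open ≡-Reasoning
  q = + suc q₀
  add-subtract : ∀ x y → x ≡ x + y - y
  add-subtract = solve-∀
  reflected : ∀ s F q → - (+ 2 * q - s + F * (+ 2 * q)) ≡ s + (- F - 1ℤ) * (+ 2 * q)
  reflected = solve-∀
  ρ+1+s₀≡2q : ρ ℕ.+ suc s₀ ≡ 2 ℕ.* suc q₀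
  ρ+1+s₀≡2q = trans (ℕP.+-suc ρ s₀) 1+ρ+s₀≡2q
  ρ≡ : + ρ ≡ + 2 * q - + suc s₀
  ρ≡ = begin
    + ρ                            ≡⟨ add-subtract (+ ρ) (+ suc s₀) ⟩
    + ρ + + suc s₀ - + suc s₀      ≡⟨ cong (λ x → x - + suc s₀) (trans (sym (pos-+ ρ (suc s₀))) (cong +_ ρ+1+s₀≡2q)) ⟩
    + 2 * q - + suc s₀             ∎
  s₀<q₀ : s₀ ℕ.< q₀
  s₀<q₀ = ℕ.s≤s⁻¹ (ℕP.+-cancelˡ-< (suc q₀) (suc s₀) (suc q₀)
            (subst (suc q₀ ℕ.+ suc s₀ ℕ.<_) (trans ρ+1+s₀≡2q (cong (suc q₀ ℕ.+_) (ℕP.+-identityʳ (suc q₀))))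
                   (ℕP.+-monoˡ-< (suc s₀) q<ρ)))

descend : ∀ p q₀ → 1 ℕ.≤ q₀ → Bezout p (+ suc q₀) → Odd′ (p + + suc q₀) → Descent p q₀ ⊎ Descent (- p) q₀
descend p q₀ 1≤q₀ bez odd with p %ℕ (2 ℕ.* suc q₀) | n%ℕd<d p (2 ℕ.* suc q₀) | a≡a%ℕn+[a/ℕn]*n p (2 ℕ.* suc q₀)
... | zero   | _    | p≡ = ⊥-elim (Bezout⇒≢*2q F 1≤q₀ bez (trans p≡ (+-identityˡ _)))
  where F = p /ℕ (2 ℕ.* suc q₀)
... | suc r₀ | ρ<2q | p≡ with ℕP.<-cmp (suc r₀) (suc q₀)
...   | tri< ρ<q _ _ = inj₁ (descent r₀ F (ℕ.s≤s⁻¹ ρ<q) p≡)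
  where F = p /ℕ (2 ℕ.* suc q₀)
...   | tri≈ _ ρ≡q _ = ⊥-elim (Odd′⇒≢q+*2q F odd (trans p≡ (cong (λ ρ → + ρ + F * (+ 2 * + suc q₀)) ρ≡q)))
  where F = p /ℕ (2 ℕ.* suc q₀)
...   | tri> _ _ q<ρ = inj₂ (descent-neg F q<ρ ρ<2q p≡)
  where F = p /ℕ (2 ℕ.* suc q₀)

Agrees : ℕ → Set
Agrees q₀ = ∀ p → Bezout p (+ suc q₀) → Odd′ (p + + suc q₀) → Agree p (suc q₀)

agree-descend : ∀ {p q₀} → Descent p q₀ → Bezout p (+ suc q₀) → Odd′ (p + + suc q₀) →
                (∀ {r₀} → r₀ ℕ.< q₀ → Agrees r₀) → Agree p (suc q₀)
agree-descend {p} {q₀} (descent r₀ M r<q p≡) bez odd agrees =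
  agree-translate q₀ M p≡ (agree-invert r₀ q₀ (ℕ.s≤s r<q) bez′ odd′ (agrees r<q (+ suc q₀) bez′ odd′))
  where
  bez′ = Bezout-descend {p} {+ suc q₀} {+ suc r₀} M p≡ bez
  odd′ = Odd′-descend {p} {+ suc q₀} {+ suc r₀} M p≡ odd

agree : ∀ q₀ → Agrees q₀
agree = <-rec Agrees step
  where
  step : ∀ q₀ → (∀ {r₀} → r₀ ℕ.< q₀ → Agrees r₀) → Agrees q₀
  step zero _ p _ odd =
    agree-base p (subst Even (p + 1ℤ + -1ℤ ≡ p ∋ solve (p ∷ [])) (Odd′-+-Odd′ odd (Odd′-neg Odd′-1)))
  step (suc q₁) agrees p bez odd with descend p (suc q₁) (ℕ.s≤s ℕ.z≤n) bez odd
  ... | inj₁ d = agree-descend d bez odd agrees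
  ... | inj₂ d = subst (λ x → Agree x (suc (suc q₁))) (neg-involutive p)
                   (agree-reflect (suc q₁) bez′ (agree-descend d bez′ (Odd′-neg-+ {p} {+ suc (suc q₁)} odd) agrees))
    where bez′ = Bezout-neg {p} {+ suc (suc q₁)} bez

Γθ-odd-sum : ∀ {a b c d} → InΓθ a b c d → Odd′ (a + c)
Γθ-odd-sum {a} {b} {c} {d} (det , 2∣a-d , 2∣b-c) with parity (a + c) | 2∣⇒Even 2∣a-d | 2∣⇒Even 2∣b-c
... | inj₂ odd          | _            | _            = odd
... | inj₁ (e , a+c≡2e) | (s , a-d≡2s) | (t , b-c≡2t) = ⊥-elim (¬Even∧Odd′ (_ , one≡) Odd′-1)
  where
  open ≡-Reasoning
  d≡ : d ≡ a - + 2 * s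
  d≡ = trans (d ≡ a - (a - d) ∋ solve (a ∷ d ∷ [])) (cong (_-_ a) a-d≡2s)
  b≡ : b ≡ c + + 2 * t
  b≡ = trans (b ≡ c + (b - c) ∋ solve (b ∷ c ∷ [])) (cong (_+_ c) b-c≡2t)
  one≡ : 1ℤ ≡ + 2 * (e * (a - c) - a * s - t * c)
  one≡ = begin
    1ℤ                                           ≡⟨ sym det ⟩
    a * d - b * c                                ≡⟨ cong₂ (λ x y → a * x - y * c) d≡ b≡ ⟩
    a * (a - + 2 * s) - (c + + 2 * t) * c        ≡⟨ solve (a ∷ c ∷ s ∷ t ∷ []) ⟩
    (a + c) * (a - c) - + 2 * (a * s + t * c)    ≡⟨ cong (λ x → x * (a - c) - + 2 * (a * s + t * c)) a+c≡2e ⟩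
    + 2 * e * (a - c) - + 2 * (a * s + t * c)    ≡⟨ solve (a ∷ c ∷ e ∷ s ∷ t ∷ []) ⟩
    + 2 * (e * (a - c) - a * s - t * c)          ∎

InΓθ⇒Bezout : ∀ {a b c d} → InΓθ a b c d → Bezout a c
InΓθ⇒Bezout {a} {b} {c} {d} (det , _) = d , - b , trans (d * a + - b * c ≡ a * d - b * c ∋ solve (a ∷ b ∷ c ∷ d ∷ [])) det

frakS-negʳ : ∀ a n → frakS a -[1+ n ] ≡ frakS (- a) (+ suc n)
frakS-negʳ a n = cong sumℤ (List.map-cong (λ k → cong (λ x → negOnePow (x /ℕ suc n + + k + 1ℤ)) (neg-distribʳ-* (+ k) a))
                                          (map suc (upTo n)))

corollary1 : (a b c d : ℤ) → InΓθ a b c d → c ≢ 0ℤ →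
    IθIs (infNum a c) (infDen c) (frakS a c)
corollary1 a b (+ zero)     d _ c≢0 = ⊥-elim (c≢0 refl)
corollary1 a b c@(+[1+ n ]) d γ _ = Agree⇒IθIs (agree n a (InΓθ⇒Bezout {a} {b} {c} {d} γ) (Γθ-odd-sum {a} {b} {c} {d} γ))
corollary1 a b c@(-[1+ n ]) d γ _ =
  subst (IθIs (- a) (suc n)) (sym (frakS-negʳ a n))
        (Agree⇒IθIs (agree n (- a) (Bezout-neg (Bezout-negʳ (InΓθ⇒Bezout {a} {b} {c} {d} γ)))
                                   (subst Odd′ (neg-distrib-+ a c) (Odd′-neg (Γθ-odd-sum {a} {b} {c} {d} γ)))))
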